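{- Let $x=[a_0,a_1,a_2,\ldots]\in\mathbb{R}\setminus\mathbb{Q}$ with convergents $s_k/t_k$, and let $k\ge0$ be such that $t_k$ and $t_{k+1}$ are both odd. Then $$\left(\frac{s_k}{t_k}\right)=\left(\frac{s_{k+1}}{t_{k+1}}\right),$$ except when either ($t_k\equiv 1\pmod 4$, $t_{k+1}\equiv 3\pmod 4$ and $k$ odd) or ($t_k\equiv 3\pmod 4$, $t_{k+1}\equiv 1\pmod 4$ and $k$ even), in which cases $$\left(\frac{s_k}{t_k}\right)=-\left(\frac{s_{k+1}}{t_{k+1}}\right).$$
   Context: The regular continued fraction $x=[a_0,a_1,a_2,\ldots]$ has $a_0\in\mathbb{Z}$, $a_k\ge1$ for $k\ge1$; the convergents $s_k/t_k$ are defined by $s_{ -1}=1$, $s_0=a_0$, $s_k=a_ks_{k-1}+s_{k-2}$ and $t_{ -1}=0$, $t_0=1$, $t_k=a_kt_{k-1}+t_{k-2}$ for $k\ge1$. For odd natural $n$ and integer $m$ with $\gcd(m,n)=1$, $\left(\frac{m}{n}\right)$ denotes the Jacobi symbol (with $\left(\frac{0}{1}\right)=1$). -}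

module Defs where

open import Data.Nat as ℕ using (ℕ; zero; suc; _≤?_)
open import Data.Nat.Divisibility using (_∣?_; divides)
open import Data.Integer as ℤ using (ℤ; +_; ∣_∣; _*_; _+_; _-_; -_; 1ℤ; 0ℤ; -1ℤ)
open import Data.Fin using (Fin; toℕ)
open import Data.Fin.Properties using (any?)
open import Data.Product using (_×_; _,_; ∃)
open import Relation.Nullary using (yes; no)

-- Convergents of the continued fraction [a 0, a 1, a 2, ...].
-- sAux n = s_(n-1), tAux n = t_(n-1), so that index -1 is representable.
sAux : (ℕ → ℤ) → ℕ → ℤ
sAux a zero = 1ℤ
sAux a (suc zero) = a 0
sAux a (suc (suc n)) = a (suc n) * sAux a (suc n) + sAux a n

tAux : (ℕ → ℤ) → ℕ → ℤ
tAux a zero = 0ℤ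
tAux a (suc zero) = 1ℤ
tAux a (suc (suc n)) = a (suc n) * tAux a (suc n) + tAux a n

s : (ℕ → ℤ) → ℕ → ℤ
s a k = sAux a (suc k)

t : (ℕ → ℤ) → ℕ → ℤ
t a k = tAux a (suc k)

legendre : ℤ → ℕ → ℤ
legendre m p with p ∣? ∣ m ∣
... | yes _ = 0ℤ
... | no _ with any? {n = p} (λ (x : Fin p) → p ∣? ∣ (+ toℕ x) * (+ toℕ x) - m ∣)
...   | yes _ = 1ℤ
...   | no _ = -1ℤ

-- search fuel d n: the least divisor e ≥ d of n, together with n / e
-- (started at d = 2 with fuel n it returns the least prime factor of n ≥ 2)
search : ℕ → ℕ → ℕ → ℕ × ℕ
search zero d n = n , 1
search (suc f) d n with d ∣? n
... | yes (divides q _) = d , q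
... | no _ = search f (suc d) n

-- Jacobi symbol with fuel: product of Legendre symbols over the prime
-- factorisation of n (with multiplicity), peeling off the least prime factor.
jac : ℕ → ℤ → ℕ → ℤ
jac zero m n = 1ℤ
jac (suc f) m n with n ≤? 1
... | yes _ = 1ℤ
... | no _ with search n 2 n
...   | p , q = legendre m p * jac f m q

-- Jacobi symbol (m / n); jacobi m 1 = 1 (in particular (0/1) = 1).
jacobi : ℤ → ℕ → ℤ
jacobi m n = jac n m n

-- The convergents satisfy s_{k+1} t_k - s_k t_{k+1} = (-1)^k, so t_k and t_{k+1} are
-- coprime, s_{k+1} t_k ≡ (-1)^k (mod t_{k+1}) and s_k t_{k+1} ≡ -(-1)^k (mod t_k).  Multiplicativity
-- of the Jacobi symbol turns these into (s_{k+1}/t_{k+1}) (t_k/t_{k+1}) = ((-1)^k/t_{k+1}) and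
-- (s_k/t_k) (t_{k+1}/t_k) = (-(-1)^k/t_k); Jacobi reciprocity for (t_k/t_{k+1}) (t_{k+1}/t_k) and the
-- supplement (-1/n) = (-1)^((n-1)/2) then leave a sign depending only on t_k, t_{k+1} mod 4 and the
-- parity of k.  Reciprocity for odd primes comes from Euler's criterion (Wilson-style pairing and
-- Gauss's lemma), Eisenstein's lemma and the lattice-point count; it extends to Jacobi symbols
-- through the prime factorisation by which `jacobi` is defined.

module Submission where

open import Defs

open import Data.Empty using (⊥; ⊥-elim)
open import Data.Fin using (Fin; toℕ; fromℕ<)
open import Data.Fin.Properties using (any?; toℕ-fromℕ<)
open import Data.Integer as ℤ using (ℤ; +_; -[1+_]; _+_; _*_; _-_; -_; ∣_∣; _^_; 0ℤ; 1ℤ; -1ℤ; _%ℕ_; _/ℕ_)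
import Data.Integer.DivMod as ℤD
open import Data.Integer.Divisibility.Signed as ℤ∣ using (_∣_)
import Data.Integer.Properties as ℤP
open import Data.Integer.Tactic.RingSolver using (solve-∀)
open import Data.List using (List; []; _∷_; _++_; length; map; foldr)
open import Data.List.Membership.Propositional using (_∈_)
open import Data.List.Membership.Propositional.Properties using (∈-∃++; ∈-map⁺; ∈-map⁻)
open import Data.List.Properties using (length-map; map-∘; map-cong; map-cong-local; map-id)
open import Data.List.Relation.Binary.Permutation.Propositional as ↭ using (_↭_; prep; ↭-sym; ↭⇒↭ₛ)
import Data.List.Relation.Binary.Permutation.Propositional.Properties as ↭
import Data.List.Relation.Binary.Permutation.Setoid.Properties as ↭ₛ
open import Data.List.Relation.Unary.All as All using (All; []; _∷_)
import Data.List.Relation.Unary.All.Properties as All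
open import Data.List.Relation.Unary.AllPairs using ([]; _∷_)
open import Data.List.Relation.Unary.Any using (here; there)
open import Data.List.Relation.Unary.Unique.Propositional using (Unique)
import Data.List.Relation.Unary.Unique.Propositional.Properties as Unique
open import Data.Nat as ℕ using (ℕ; zero; suc; _≤_; _<_; z≤n; s≤s; NonZero; _<?_; _≤?_; _≟_; _⊓_)
open import Data.List.Membership.DecPropositional ℕ._≟_ using (_∈?_)
open import Data.Nat.Coprimality using (Coprime; coprime-Bézout)
import Data.Nat.DivMod as ℕD
open import Data.Nat.Divisibility as ℕ∣ using (_∣?_; divides) renaming (_∣_ to _∣ℕ_)
open import Data.Nat.GCD using (module Bézout)
open import Data.Nat.Induction using (<-rec)
open import Data.Nat.ListAction using (sum)
import Data.Nat.ListAction.Properties as ℕL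
open import Data.Nat.Primality
  using (Prime; euclidsLemma; prime⇒nonTrivial; prime⇒irreducible; prime⇒nonZero; _Rough_; 2-rough; ∤⇒rough-suc; rough∧∣⇒prime; rough⇒≤)
import Data.Nat.Properties as ℕP
import Data.Nat.Tactic.RingSolver as ℕS
import Data.Product
open import Data.Product using (_×_; _,_; proj₁; proj₂; Σ; curry; uncurry)
import Data.Sum
open import Data.Sum using (_⊎_; inj₁; inj₂; [_,_]′)
open import Function using (_∘_; id)
open import Relation.Binary.Bundles using (Setoid)
open import Relation.Binary.PropositionalEquality
import Relation.Binary.Reasoning.Setoid as ≈-Reasoning
open import Relation.Binary.Structures using (IsEquivalence)
open import Relation.Nullary using (¬_; Dec; yes; no)
import Relation.Nullary.Decidable as Dec

-1^ : ℕ → ℤ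
-1^ n = -1ℤ ^ n

-1^-+ : ∀ m n → -1^ (m ℕ.+ n) ≡ -1^ m * -1^ n
-1^-+ = ℤP.^-distribˡ-+-* -1ℤ

-1^-+2* : ∀ m c → -1^ (m ℕ.+ 2 ℕ.* c) ≡ -1^ m
-1^-+2* m c = begin
  -1^ (m ℕ.+ 2 ℕ.* c)       ≡⟨ -1^-+ m (2 ℕ.* c) ⟩
  -1^ m * -1ℤ ^ (2 ℕ.* c)   ≡⟨ cong (-1^ m *_) (sym (ℤP.^-*-assoc -1ℤ 2 c)) ⟩
  -1^ m * 1ℤ ^ c            ≡⟨ cong (-1^ m *_) (ℤP.^-zeroˡ c) ⟩
  -1^ m * 1ℤ                ≡⟨ ℤP.*-identityʳ (-1^ m) ⟩
  -1^ m                     ∎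
  where open ≡-Reasoning

-1^-parity : ∀ {m n} c d → m ℕ.+ 2 ℕ.* c ≡ n ℕ.+ 2 ℕ.* d → -1^ m ≡ -1^ n
-1^-parity {m} {n} c d eq = trans (sym (-1^-+2* m c)) (trans (cong -1^ eq) (-1^-+2* n d))

-1^-square : ∀ n → -1^ n * -1^ n ≡ 1ℤ
-1^-square n = trans (sym (-1^-+ n n)) (trans (cong -1^ (sym (cong (n ℕ.+_) (ℕP.+-identityʳ n)))) (-1^-+2* 0 n))

-1^-cases : ∀ n → -1^ n ≡ 1ℤ ⊎ -1^ n ≡ -1ℤ
-1^-cases zero    = inj₁ refl
-1^-cases (suc n) with -1^-cases n
... | inj₁ eq = inj₂ (cong (-1ℤ *_) eq)
... | inj₂ eq = inj₁ (cong (-1ℤ *_) eq)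

^-distrib-* : ∀ a b k → (a * b) ^ k ≡ a ^ k * b ^ k
^-distrib-* a b zero    = refl
^-distrib-* a b (suc k) = trans (cong (a * b *_) (^-distrib-* a b k)) (interchange a b (a ^ k) (b ^ k))
  where
  interchange : ∀ a b c d → a * b * (c * d) ≡ a * c * (b * d)
  interchange = solve-∀

∣∣≤1-* : ∀ a b → ∣ a ∣ ≤ 1 → ∣ b ∣ ≤ 1 → ∣ a * b ∣ ≤ 1
∣∣≤1-* a b ∣a∣≤1 ∣b∣≤1 = subst (_≤ 1) (sym (ℤP.abs-* a b)) (ℕP.*-mono-≤ ∣a∣≤1 ∣b∣≤1)

∣-1^∣≡1 : ∀ n → ∣ -1^ n ∣ ≡ 1
∣-1^∣≡1 zero    = refl
∣-1^∣≡1 (suc n) = trans (ℤP.abs-* -1ℤ (-1^ n)) (trans (ℕP.*-identityˡ _) (∣-1^∣≡1 n))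

∣-1^∣≤1 : ∀ n → ∣ -1^ n ∣ ≤ 1
∣-1^∣≤1 n = ℕP.≤-reflexive (∣-1^∣≡1 n)

unit-∣∣≤1 : ∀ {a b c} → ∣ a ∣ ≤ 1 → a * b ≡ c → c * c ≡ 1ℤ → a * a ≡ 1ℤ
unit-∣∣≤1 {+ 0}          _              refl ()
unit-∣∣≤1 {+ 1}          _              _    _ = refl
unit-∣∣≤1 {+ suc (suc _)} (s≤s ())
unit-∣∣≤1 { -[1+ 0 ]}    _              _    _ = refl
unit-∣∣≤1 { -[1+ suc _ ]} (s≤s ())

cancel-signs : ∀ a d m → a * a ≡ 1ℤ → d * d ≡ 1ℤ → a ≡ d * (a * m) → m ≡ d
cancel-signs a d m a²≡1 d²≡1 a≡dam = begin
  m                          ≡⟨ trans (sym (ℤP.*-identityˡ m)) (sym (ℤP.*-identityˡ _)) ⟩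
  1ℤ * (1ℤ * m)              ≡⟨ cong₂ (λ u v → u * (v * m)) d²≡1 a²≡1 ⟨
  d * d * (a * a * m)        ≡⟨ regroup a d m ⟩
  d * (d * (a * m)) * a      ≡⟨ cong (λ z → d * z * a) a≡dam ⟨
  d * a * a                  ≡⟨ ℤP.*-assoc d a a ⟩
  d * (a * a)                ≡⟨ cong (d *_) a²≡1 ⟩
  d * 1ℤ                     ≡⟨ ℤP.*-identityʳ d ⟩
  d                          ∎
  where
  open ≡-Reasoning
  regroup : ∀ a d m → d * d * (a * a * m) ≡ d * (d * (a * m)) * a
  regroup = solve-∀

+-double-injective : ∀ {m n} → m ℕ.+ m ≡ n ℕ.+ n → m ≡ n
+-double-injective {m} {n} eq = ℕP.*-cancelˡ-≡ m n 2 (trans (double m) (trans eq (sym (double n))))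
  where
  double : ∀ k → 2 ℕ.* k ≡ k ℕ.+ k
  double k = cong (k ℕ.+_) (ℕP.+-identityʳ k)

0^-pos : ∀ {k} → 1 ≤ k → 0ℤ ^ k ≡ 0ℤ
0^-pos (s≤s _) = refl

≤⇒<1+2* : ∀ {x h} → x ≤ h → x < suc (h ℕ.+ h)
≤⇒<1+2* {h = h} x≤h = s≤s (ℕP.≤-trans x≤h (ℕP.m≤m+n h h))

prime⇒1< : ∀ {p} → Prime p → 1 < p
prime⇒1< {p} p-prime = ℕ.nonTrivial⇒n>1 p {{prime⇒nonTrivial p-prime}}

range : ℕ → List ℕ
range zero    = []
range (suc n) = suc n ∷ range n

_∈[1,_] : ℕ → ℕ → Set
x ∈[1, n ] = 1 ≤ x × x ≤ n

∈-range⁻ : ∀ {x} n → x ∈ range n → x ∈[1, n ]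
∈-range⁻ (suc n) (here refl) = s≤s z≤n , ℕP.≤-refl
∈-range⁻ (suc n) (there x∈) = Data.Product.map₂ ℕP.m≤n⇒m≤1+n (∈-range⁻ n x∈)

∈-range⁺ : ∀ {x} n → x ∈[1, n ] → x ∈ range n
∈-range⁺ zero    (1≤x , x≤0) = ⊥-elim (ℕP.<⇒≱ 1≤x x≤0)
∈-range⁺ {x} (suc n) (1≤x , x≤1+n) with x ≟ suc n
... | yes refl = here refl
... | no  x≢1+n = there (∈-range⁺ n (1≤x , ℕP.≤-pred (ℕP.≤∧≢⇒< x≤1+n x≢1+n)))

length-range : ∀ n → length (range n) ≡ n
length-range zero    = refl
length-range (suc n) = cong suc (length-range n)

range-unique : ∀ n → Unique (range n)
range-unique zero    = []
range-unique (suc n) = All.tabulate (λ x∈ 1+n≡x → ℕP.<-irrefl (sym 1+n≡x) (s≤s (proj₂ (∈-range⁻ n x∈)))) ∷ range-unique n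

unique-map⁺ : ∀ {f : ℕ → ℕ} {xs} → (∀ {x y} → x ∈ xs → y ∈ xs → f x ≡ f y → x ≡ y) → Unique xs → Unique (map f xs)
unique-map⁺ {xs = []}     _   []          = []
unique-map⁺ {xs = x ∷ xs} inj (x∉xs ∷ u) =
  All.map⁺ (All.tabulate (λ y∈xs fx≡fy → All.lookup x∉xs y∈xs (inj (here refl) (there y∈xs) fx≡fy)))
  ∷ unique-map⁺ (λ x∈ y∈ → inj (there x∈) (there y∈)) u

∈⇒↭∷ : ∀ {x : ℕ} {xs} → x ∈ xs → Σ (List ℕ) λ ys → xs ↭ x ∷ ys
∈⇒↭∷ x∈xs with ys , zs , refl ← ∈-∃++ x∈xs = ys ++ zs , ↭.shift _ ys zs

unique-resp-↭ : ∀ {xs ys : List ℕ} → xs ↭ ys → Unique xs → Unique ys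
unique-resp-↭ xs↭ys = ↭ₛ.Unique-resp-↭ (setoid ℕ) (↭⇒↭ₛ xs↭ys)

private
  below-top : ∀ {n xs} → All (_∈[1, suc n ]) xs → All (λ x → ¬ suc n ≡ x) xs → All (_∈[1, n ]) xs
  below-top = curry (All.zipWith λ ((1≤x , x≤1+n) , 1+n≢x) → 1≤x , ℕP.≤-pred (ℕP.≤∧≢⇒< x≤1+n (1+n≢x ∘ sym)))

  remove-top : ∀ {n xs} → Unique xs → All (_∈[1, suc n ]) xs → suc n ∈ xs →
               Σ (List ℕ) λ ys → xs ↭ suc n ∷ ys × Unique ys × All (_∈[1, n ]) ys
  remove-top u b 1+n∈xs with ys , xs↭ ← ∈⇒↭∷ 1+n∈xs
                        with 1+n∉ys ∷ uys ← unique-resp-↭ xs↭ u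
    = ys , xs↭ , uys , below-top (All.tail (↭.All-resp-↭ xs↭ b)) 1+n∉ys

unique-length≤ : ∀ n {xs} → Unique xs → All (_∈[1, n ]) xs → length xs ≤ n
unique-length≤ zero    _ []                   = z≤n
unique-length≤ zero    _ ((1≤x , x≤0) ∷ _)    = ⊥-elim (ℕP.<⇒≱ 1≤x x≤0)
unique-length≤ (suc n) {xs} u b with suc n ∈? xs
... | yes 1+n∈xs = let ys , xs↭ , uys , bys = remove-top u b 1+n∈xs in
  subst (_≤ suc n) (sym (↭.↭-length xs↭)) (s≤s (unique-length≤ n uys bys))
... | no  1+n∉xs = ℕP.m≤n⇒m≤1+n (unique-length≤ n u (below-top b (All.¬Any⇒All¬ xs 1+n∉xs)))

unique-length≡⇒↭range : ∀ n {xs} → Unique xs → All (_∈[1, n ]) xs → length xs ≡ n → xs ↭ range n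
unique-length≡⇒↭range zero    {[]} _ _ _ = ↭.refl
unique-length≡⇒↭range (suc n) {xs} u b len with suc n ∈? xs
... | yes 1+n∈xs = let ys , xs↭ , uys , bys = remove-top u b 1+n∈xs in
  ↭.trans xs↭ (prep (suc n) (unique-length≡⇒↭range n uys bys (ℕP.suc-injective (trans (sym (↭.↭-length xs↭)) len))))
... | no  1+n∉xs = ⊥-elim (ℕP.<-irrefl len (s≤s (unique-length≤ n u (below-top b (All.¬Any⇒All¬ xs 1+n∉xs)))))

∏ : List ℤ → ℤ
∏ = foldr _*_ 1ℤ

∏-↭ : ∀ {as bs} → as ↭ bs → ∏ as ≡ ∏ bs
∏-↭ as↭bs = ↭ₛ.foldr-commMonoid (setoid ℤ) ℤP.*-1-isCommutativeMonoid (↭⇒↭ₛ as↭bs)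

∏-map-* : ∀ (f g : ℕ → ℤ) xs → ∏ (map (λ x → f x * g x) xs) ≡ ∏ (map f xs) * ∏ (map g xs)
∏-map-* f g []       = refl
∏-map-* f g (x ∷ xs) = trans (cong (f x * g x *_) (∏-map-* f g xs)) (interchange (f x) (g x) _ _)
  where
  interchange : ∀ a b c d → a * b * (c * d) ≡ a * c * (b * d)
  interchange = solve-∀

∏-map-const : ∀ a (xs : List ℕ) → ∏ (map (λ _ → a) xs) ≡ a ^ length xs
∏-map-const a []       = refl
∏-map-const a (x ∷ xs) = cong (a *_) (∏-map-const a xs)

∏-map--1^ : ∀ (f : ℕ → ℕ) xs → ∏ (map (λ x → -1^ (f x)) xs) ≡ -1^ (sum (map f xs))
∏-map--1^ f []       = refl
∏-map--1^ f (x ∷ xs) = trans (cong (-1^ (f x) *_) (∏-map--1^ f xs)) (sym (-1^-+ (f x) _))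

∏-range-suc : ∀ n → ∏ (map +_ (range (suc n))) ≡ ∏ (map +_ (map suc (range n)))
∏-range-suc zero    = refl
∏-range-suc (suc n) = cong (+ suc (suc n) *_) (∏-range-suc n)

𝟙 : ∀ {A : Set} → Dec A → ℕ
𝟙 (yes _) = 1
𝟙 (no  _) = 0

𝟙-cong : ∀ {A B : Set} → (A → B) → (B → A) → (a : Dec A) (b : Dec B) → 𝟙 a ≡ 𝟙 b
𝟙-cong A⇒B B⇒A (yes a) (yes b) = refl
𝟙-cong A⇒B B⇒A (yes a) (no ¬b) = ⊥-elim (¬b (A⇒B a))
𝟙-cong A⇒B B⇒A (no ¬a) (yes b) = ⊥-elim (¬a (B⇒A b))
𝟙-cong A⇒B B⇒A (no ¬a) (no ¬b) = refl

𝟙-<-trichotomy : ∀ {a b} → ¬ a ≡ b → 𝟙 (a <? b) ℕ.+ 𝟙 (b <? a) ≡ 1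
𝟙-<-trichotomy {a} {b} a≢b with a <? b | b <? a
... | yes a<b | yes b<a = ⊥-elim (ℕP.<-asym a<b b<a)
... | yes _   | no  _   = refl
... | no  _   | yes _   = refl
... | no  a≮b | no  b≮a = ⊥-elim (a≢b (ℕP.≤-antisym (ℕP.≮⇒≥ b≮a) (ℕP.≮⇒≥ a≮b)))

sum-map-+ : ∀ (f g : ℕ → ℕ) xs → sum (map (λ x → f x ℕ.+ g x) xs) ≡ sum (map f xs) ℕ.+ sum (map g xs)
sum-map-+ f g []       = refl
sum-map-+ f g (x ∷ xs) = trans (cong (f x ℕ.+ g x ℕ.+_) (sum-map-+ f g xs)) (interchange (f x) (g x) _ _)
  where
  interchange : ∀ a b c d → a ℕ.+ b ℕ.+ (c ℕ.+ d) ≡ a ℕ.+ c ℕ.+ (b ℕ.+ d)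
  interchange = ℕS.solve-∀

sum-map-const : ∀ c (xs : List ℕ) → sum (map (λ _ → c) xs) ≡ length xs ℕ.* c
sum-map-const c []       = refl
sum-map-const c (x ∷ xs) = cong (c ℕ.+_) (sum-map-const c xs)

sum-map-cong : ∀ {f g : ℕ → ℕ} {xs} → All (λ x → f x ≡ g x) xs → sum (map f xs) ≡ sum (map g xs)
sum-map-cong = cong sum ∘ map-cong-local

sum-swap : ∀ (F : ℕ → ℕ → ℕ) xs ys →
           sum (map (λ y → sum (map (λ x → F x y) xs)) ys) ≡ sum (map (λ x → sum (map (F x) ys)) xs)
sum-swap F []       ys = trans (sum-map-const 0 ys) (ℕP.*-zeroʳ (length ys))
sum-swap F (x ∷ xs) ys = trans (sum-map-+ (F x) (λ y → sum (map (λ x′ → F x′ y) xs)) ys)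
                               (cong (sum (map (F x) ys) ℕ.+_) (sum-swap F xs ys))

count-≤ : ∀ f K → sum (map (λ y → 𝟙 (y ≤? f)) (range K)) ≡ K ⊓ f
count-≤ f zero    = refl
count-≤ f (suc K) with suc K ≤? f
... | yes K<f = trans (cong suc (trans (count-≤ f K) (ℕP.m≤n⇒m⊓n≡m (ℕP.<⇒≤ K<f)))) (sym (ℕP.m≤n⇒m⊓n≡m K<f))
... | no  K≮f = trans (count-≤ f K) (trans (ℕP.m≥n⇒m⊓n≡n f≤K) (sym (ℕP.m≥n⇒m⊓n≡n (ℕP.m≤n⇒m≤1+n f≤K))))
  where
  f≤K : f ≤ K
  f≤K = ℕP.≤-pred (ℕP.≰⇒> K≮f)

count-multiples : ∀ P N K .{{_ : NonZero P}} → ¬ P ∣ℕ N → N < suc K ℕ.* P →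
                  sum (map (λ y → 𝟙 (P ℕ.* y <? N)) (range K)) ≡ N ℕ./ P
count-multiples P N K P∤N N<[K+1]P = begin
  sum (map (λ y → 𝟙 (P ℕ.* y <? N)) (range K)) ≡⟨ sum-map-cong {xs = range K} (All.tabulate λ {y} _ →
                                                      𝟙-cong (Py<N⇒y≤N/P y) (y≤N/P⇒Py<N y) (P ℕ.* y <? N) (y ≤? N ℕ./ P)) ⟩
  sum (map (λ y → 𝟙 (y ≤? N ℕ./ P)) (range K))  ≡⟨ count-≤ (N ℕ./ P) K ⟩
  K ⊓ (N ℕ./ P)                                  ≡⟨ ℕP.m≥n⇒m⊓n≡n (ℕP.≤-pred (ℕD.m<n*o⇒m/o<n N<[K+1]P)) ⟩
  N ℕ./ P                                        ∎
  where
  open ≡-Reasoning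
  N<[N/P+1]P : N < suc (N ℕ./ P) ℕ.* P
  N<[N/P+1]P = subst (_< suc (N ℕ./ P) ℕ.* P) (sym (ℕD.m≡m%n+[m/n]*n N P)) (ℕP.+-monoˡ-< (N ℕ./ P ℕ.* P) (ℕD.m%n<n N P))
  Py<N⇒y≤N/P : ∀ y → P ℕ.* y < N → y ≤ N ℕ./ P
  Py<N⇒y≤N/P y Py<N = ℕP.≮⇒≥ λ N/P<y →
    ℕP.<-asym Py<N (ℕP.<-≤-trans N<[N/P+1]P (subst (suc (N ℕ./ P) ℕ.* P ≤_) (ℕP.*-comm y P) (ℕP.*-monoˡ-≤ P N/P<y)))
  y≤N/P⇒Py<N : ∀ y → y ≤ N ℕ./ P → P ℕ.* y < N
  y≤N/P⇒Py<N y y≤N/P = ℕP.≤∧≢⇒< (ℕP.≤-trans (subst (_≤ N ℕ./ P ℕ.* P) (ℕP.*-comm y P) (ℕP.*-monoˡ-≤ P y≤N/P)) (ℕD.m/n*n≤m N P))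
                                 (λ Py≡N → P∤N (divides y (trans (sym Py≡N) (ℕP.*-comm P y))))

module Mod (n : ℕ) where

  -- A record rather than + n ∣ a - b, so that a and b stay inferable.
  infix 4 _≈_
  record _≈_ (a b : ℤ) : Set where
    constructor mod-intro
    field divides-difference : + n ∣ a - b

  private
    ∣-by : ∀ {x y} → x ≡ y → + n ∣ x → + n ∣ y
    ∣-by = subst (+ n ∣_)

  ≈-intro : ∀ {a b} q → a ≡ b + q * + n → a ≈ b
  ≈-intro {a} {b} q refl = mod-intro (ℤ∣.divides q (b+qn-b≡qn b q (+ n)))
    where
    b+qn-b≡qn : ∀ b q n → b + q * n - b ≡ q * n
    b+qn-b≡qn = solve-∀

  ≈-refl : ∀ {a} → a ≈ a
  ≈-refl {a} = mod-intro (∣-by (sym (ℤP.+-inverseʳ a)) (ℤ∣.divides 0ℤ refl))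

  ≈-reflexive : ∀ {a b} → a ≡ b → a ≈ b
  ≈-reflexive refl = ≈-refl

  ≈-sym : ∀ {a b} → a ≈ b → b ≈ a
  ≈-sym {a} {b} (mod-intro d) = mod-intro (∣-by (-[a-b]≡b-a a b) (ℤ∣.∣m⇒∣-m d))
    where
    -[a-b]≡b-a : ∀ a b → - (a - b) ≡ b - a
    -[a-b]≡b-a = solve-∀

  ≈-trans : ∀ {a b c} → a ≈ b → b ≈ c → a ≈ c
  ≈-trans {a} {b} {c} (mod-intro d) (mod-intro e) = mod-intro (∣-by (telescope a b c) (ℤ∣.∣m∣n⇒∣m+n d e))
    where
    telescope : ∀ a b c → (a - b) + (b - c) ≡ a - c
    telescope = solve-∀

  ≈-isEquivalence : IsEquivalence _≈_
  ≈-isEquivalence = record { refl = ≈-refl ; sym = ≈-sym ; trans = ≈-trans }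

  ≈-setoid : Setoid _ _
  ≈-setoid = record { isEquivalence = ≈-isEquivalence }

  +-cong : ∀ {a b c d} → a ≈ b → c ≈ d → a + c ≈ b + d
  +-cong {a} {b} {c} {d} (mod-intro e) (mod-intro f) = mod-intro (∣-by (regroup a b c d) (ℤ∣.∣m∣n⇒∣m+n e f))
    where
    regroup : ∀ a b c d → (a - b) + (c - d) ≡ (a + c) - (b + d)
    regroup = solve-∀

  *-cong : ∀ {a b c d} → a ≈ b → c ≈ d → a * c ≈ b * d
  *-cong {a} {b} {c} {d} (mod-intro e) (mod-intro f) =
    mod-intro (∣-by (regroup a b c d) (ℤ∣.∣m∣n⇒∣m+n (ℤ∣.∣m⇒∣m*n c e) (ℤ∣.∣n⇒∣m*n b f)))
    where
    regroup : ∀ a b c d → (a - b) * c + b * (c - d) ≡ a * c - b * d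
    regroup = solve-∀

  *-congˡ : ∀ a {b c} → b ≈ c → a * b ≈ a * c
  *-congˡ a = *-cong (≈-refl {a})

  *-congʳ : ∀ c {a b} → a ≈ b → a * c ≈ b * c
  *-congʳ c a≈b = *-cong a≈b (≈-refl {c})

  -‿cong : ∀ {a b} → a ≈ b → - a ≈ - b
  -‿cong {a} {b} (mod-intro e) = mod-intro (∣-by (regroup a b) (ℤ∣.∣m⇒∣-m e))
    where
    regroup : ∀ a b → - (a - b) ≡ - a - - b
    regroup = solve-∀

  ^-cong : ∀ {a b} k → a ≈ b → a ^ k ≈ b ^ k
  ^-cong zero    _ = ≈-refl
  ^-cong (suc k) e = *-cong e (^-cong k e)

  ≈⇒-≈0 : ∀ {a b} → a ≈ b → a - b ≈ 0ℤ
  ≈⇒-≈0 (mod-intro d) = mod-intro (∣-by (sym (ℤP.+-identityʳ _)) d)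

  -≈0⇒≈ : ∀ {a b} → a - b ≈ 0ℤ → a ≈ b
  -≈0⇒≈ (mod-intro d) = mod-intro (∣-by (ℤP.+-identityʳ _) d)

  ≈0⇒∣ : ∀ {a} → a ≈ 0ℤ → n ∣ℕ ∣ a ∣
  ≈0⇒∣ {a} (mod-intro d) = subst (λ z → n ∣ℕ ∣ z ∣) (ℤP.+-identityʳ a) (ℤ∣.∣⇒∣ᵤ d)

  ∣⇒≈0 : ∀ {a} → n ∣ℕ ∣ a ∣ → a ≈ 0ℤ
  ∣⇒≈0 {a} d = mod-intro (∣-by (sym (ℤP.+-identityʳ a)) (ℤ∣.∣ᵤ⇒∣ d))

  ∣-resp-≈ : ∀ {a b} → a ≈ b → n ∣ℕ ∣ a ∣ → n ∣ℕ ∣ b ∣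
  ∣-resp-≈ a≈b n∣a = ≈0⇒∣ (≈-trans (≈-sym a≈b) (∣⇒≈0 n∣a))

  ≈-%ℕ : .{{_ : NonZero n}} → ∀ a → a ≈ + (a %ℕ n)
  ≈-%ℕ a = ≈-intro (a /ℕ n) (ℤD.a≡a%ℕn+[a/ℕn]*n a n)

  ≈⇒≡ : ∀ {a b} → a ≈ b → ∣ a - b ∣ < n → a ≡ b
  ≈⇒≡ {a} {b} (mod-intro d) lt = ℤP.i-j≡0⇒i≡j a b (ℤP.∣i∣≡0⇒i≡0 (ℕP.n≤0⇒n≡0 (ℕP.≮⇒≥ ∣a-b∣≮0)))
    where
    ∣a-b∣≮0 : ¬ 0 < ∣ a - b ∣
    ∣a-b∣≮0 pos = ℕP.<⇒≱ lt (ℕ∣.∣⇒≤ {{ℕ.>-nonZero pos}} (ℤ∣.∣⇒∣ᵤ d))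

  +≈+⇒≡ : ∀ {x y} → + x ≈ + y → x < n → y < n → x ≡ y
  +≈+⇒≡ {x} {y} e x<n y<n = ℤP.+-injective (≈⇒≡ e ∣x-y∣<n)
    where
    ∣x-y∣<n : ∣ + x - + y ∣ < n
    ∣x-y∣<n = ℕP.≤-<-trans (subst (ℕ._≤ x ℕ.⊔ y) (cong ∣_∣ (sym (ℤP.m-n≡m⊖n x y))) (ℤP.∣m⊝n∣≤m⊔n x y))
                          (ℕP.⊔-lub x<n y<n)

  +≉0 : ∀ {x} → 0 < x → x < n → ¬ + x ≈ 0ℤ
  +≉0 0<x x<n x≈0 = ℕP.<⇒≢ 0<x (sym (+≈+⇒≡ x≈0 x<n (ℕP.<-trans 0<x x<n)))

  ≈⇒≡-∣∣≤1 : ∀ {a b} → 3 ≤ n → ∣ a ∣ ≤ 1 → ∣ b ∣ ≤ 1 → a ≈ b → a ≡ b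
  ≈⇒≡-∣∣≤1 {a} {b} 3≤n ∣a∣≤1 ∣b∣≤1 a≈b =
    ≈⇒≡ a≈b (ℕP.≤-<-trans (ℤP.∣i-j∣≤∣i∣+∣j∣ a b) (ℕP.<-≤-trans (s≤s (ℕP.+-mono-≤ ∣a∣≤1 ∣b∣≤1)) 3≤n))

  ∏-cong : ∀ {f g : ℕ → ℤ} {xs} → All (λ x → f x ≈ g x) xs → ∏ (map f xs) ≈ ∏ (map g xs)
  ∏-cong []             = ≈-refl
  ∏-cong (fx≈gx ∷ eqs) = *-cong fx≈gx (∏-cong eqs)

  module _ (n-prime : Prime n) where

    1≉0 : ¬ 1ℤ ≈ 0ℤ
    1≉0 1≈0 = ℕP.<⇒≢ (prime⇒1< n-prime) (sym (ℕ∣.∣1⇒≡1 (≈0⇒∣ 1≈0)))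

    *≈0⇒≈0⊎≈0 : ∀ {a b} → a * b ≈ 0ℤ → a ≈ 0ℤ ⊎ b ≈ 0ℤ
    *≈0⇒≈0⊎≈0 {a} {b} e =
      Data.Sum.map ∣⇒≈0 ∣⇒≈0 (euclidsLemma ∣ a ∣ ∣ b ∣ n-prime (subst (n ∣ℕ_) (ℤP.abs-* a b) (≈0⇒∣ e)))

    *-cancelʳ-≈ : ∀ {a b c} → ¬ c ≈ 0ℤ → a * c ≈ b * c → a ≈ b
    *-cancelʳ-≈ {a} {b} {c} c≉0 e =
      [ -≈0⇒≈ , (λ c≈0 → ⊥-elim (c≉0 c≈0)) ]′ (*≈0⇒≈0⊎≈0 (≈-trans (≈-reflexive (distrib a b c)) (≈⇒-≈0 e)))
      where
      distrib : ∀ a b c → (a - b) * c ≡ a * c - b * c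
      distrib = solve-∀

    ∏≉0 : ∀ {as} → All (λ a → ¬ a ≈ 0ℤ) as → ¬ ∏ as ≈ 0ℤ
    ∏≉0 []               = 1≉0
    ∏≉0 (a≉0 ∷ as≉0) e = [ a≉0 , ∏≉0 as≉0 ]′ (*≈0⇒≈0⊎≈0 e)

    inverse : ∀ {x} → ¬ + x ≈ 0ℤ → Σ ℤ λ u → + x * u ≈ 1ℤ
    inverse {x} x≉0 = from-Bézout (coprime-Bézout n⊥x)
      where
      n⊥x : Coprime n x
      n⊥x (d∣n , d∣x) = [ id , (λ d≡n → ⊥-elim (x≉0 (∣⇒≈0 (subst (_∣ℕ x) d≡n d∣x)))) ]′ (prime⇒irreducible n-prime d∣n)
      lift : ∀ a b c d → 1 ℕ.+ a ℕ.* b ≡ c ℕ.* d → 1ℤ + + a * + b ≡ + c * + d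
      lift a b c d eq = trans (cong (λ z → 1ℤ + z) (sym (ℤP.pos-* a b)))
                              (trans (sym (ℤP.pos-+ 1 (a ℕ.* b))) (trans (cong +_ eq) (ℤP.pos-* c d)))
      from-Bézout : Bézout.Identity 1 n x → Σ ℤ λ u → + x * u ≈ 1ℤ
      from-Bézout (Bézout.+- a b eq) =
        - + b , ≈-intro (- + a) (trans (rearrange (+ x) (+ b)) (trans (cong (λ z → 1ℤ - z) (lift b x a n eq)) (rearrange′ (+ a) (+ n))))
        where
        rearrange : ∀ x b → x * - b ≡ 1ℤ - (1ℤ + b * x)
        rearrange = solve-∀
        rearrange′ : ∀ a n → 1ℤ - a * n ≡ 1ℤ + - a * n
        rearrange′ = solve-∀
      from-Bézout (Bézout.-+ a b eq) = + b , ≈-intro (+ a) (trans (ℤP.*-comm (+ x) (+ b)) (sym (lift a n b x eq)))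

    square≈1⇒≈1⊎≈-1 : ∀ {a} → a * a ≈ 1ℤ → a ≈ 1ℤ ⊎ a ≈ -1ℤ
    square≈1⇒≈1⊎≈-1 {a} a²≈1 = Data.Sum.map -≈0⇒≈ -≈0⇒≈ (*≈0⇒≈0⊎≈0 (≈-trans (≈-reflexive (factor a)) (≈⇒-≈0 a²≈1)))
      where
      factor : ∀ a → (a - 1ℤ) * (a - -1ℤ) ≡ a * a - 1ℤ
      factor = solve-∀

    HasPartner : ℤ → List ℕ → ℕ → Set
    HasPartner m xs x = Σ ℕ λ y → y ∈ xs × ¬ y ≡ x × + x * + y ≈ m

    pairing : ∀ {m} ℓ {xs} → length xs ≡ ℓ → Unique xs → All (λ x → 0 < x × x < n) xs →
              (∀ {x} → x ∈ xs → HasPartner m xs x) → Σ ℕ λ k → ℓ ≡ k ℕ.+ k × ∏ (map +_ xs) ≈ m ^ k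
    pairing zero {[]} _ _ _ _ = 0 , refl , ≈-refl
    pairing (suc zero) {x ∷ []} _ _ _ partner with partner (here refl)
    ... | _ , here y≡x , y≢x , _ = ⊥-elim (y≢x y≡x)
    pairing {m} (suc (suc ℓ)) {x ∷ ys} len (x∉ys ∷ uys) (bx ∷ bys) partner with partner (here refl)
    ... | y , here y≡x , y≢x , _ = ⊥-elim (y≢x y≡x)
    ... | y , there y∈ys , _ , xy≈m
      with zs , ys↭ ← ∈⇒↭∷ y∈ys
      with y∉zs ∷ uzs ← unique-resp-↭ ys↭ uys
      with by ∷ bzs ← ↭.All-resp-↭ ys↭ bys
      = suc k , length≡ , ∏≈
      where
      x∉zs : All (λ z → ¬ x ≡ z) zs
      x∉zs = All.tail (↭.All-resp-↭ ys↭ x∉ys)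

      -- The partner of z ∈ zs is neither x nor y, because partners are unique.
      partner′ : ∀ {z} → z ∈ zs → HasPartner m zs z
      partner′ {z} z∈zs
        with w , w∈xs , w≢z , zw≈m ← partner (there (↭.∈-resp-↭ (↭-sym ys↭) (there z∈zs)))
        with ↭.∈-resp-↭ (prep x ys↭) w∈xs
      ... | here refl = ⊥-elim (All.lookup y∉zs z∈zs (sym (+≈+⇒≡ z≈y (proj₂ (All.lookup bzs z∈zs)) (proj₂ by))))
        where
        z≈y : + z ≈ + y
        z≈y = *-cancelʳ-≈ (uncurry +≉0 bx) (≈-trans zw≈m (≈-trans (≈-sym xy≈m) (≈-reflexive (ℤP.*-comm (+ x) (+ y)))))
      ... | there (here refl) = ⊥-elim (All.lookup x∉zs z∈zs (sym (+≈+⇒≡ z≈x (proj₂ (All.lookup bzs z∈zs)) (proj₂ bx))))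
        where
        z≈x : + z ≈ + x
        z≈x = *-cancelʳ-≈ (uncurry +≉0 by) (≈-trans zw≈m (≈-sym xy≈m))
      ... | there (there w∈zs) = w , w∈zs , w≢z , zw≈m

      IH : Σ ℕ λ k → ℓ ≡ k ℕ.+ k × ∏ (map +_ zs) ≈ m ^ k
      IH = pairing ℓ (ℕP.suc-injective (trans (sym (↭.↭-length ys↭)) (ℕP.suc-injective len))) uzs bzs partner′
      k : ℕ
      k = proj₁ IH

      length≡ : suc (suc ℓ) ≡ suc k ℕ.+ suc k
      length≡ = cong suc (trans (cong suc (proj₁ (proj₂ IH))) (sym (ℕP.+-suc k k)))

      ∏≈ : ∏ (map +_ (x ∷ ys)) ≈ m ^ suc k
      ∏≈ = begin
        + x * ∏ (map +_ ys)          ≡⟨ cong (+ x *_) (∏-↭ (↭.map⁺ +_ ys↭)) ⟩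
        + x * (+ y * ∏ (map +_ zs))  ≈⟨ *-congˡ (+ x) (*-congˡ (+ y) (proj₂ (proj₂ IH))) ⟩
        + x * (+ y * m ^ k)          ≡⟨ ℤP.*-assoc (+ x) (+ y) (m ^ k) ⟨
        + x * + y * m ^ k            ≈⟨ *-congʳ (m ^ k) xy≈m ⟩
        m ^ suc k                    ∎
        where open ≈-Reasoning ≈-setoid

≈-∣ : ∀ {d n a b} → d ∣ℕ n → Mod._≈_ n a b → Mod._≈_ d a b
≈-∣ d∣n (Mod.mod-intro n∣a-b) = Mod.mod-intro (ℤ∣.∣-trans (ℤ∣.∣ᵤ⇒∣ d∣n) n∣a-b)

-- The Legendre symbol

module Legendre (p : ℕ) .{{_ : NonZero p}} where
  open Mod p

  IsSquare : ℤ → Set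
  IsSquare m = Σ ℤ λ x → x * x ≈ m

  private
    -- The search performed by `legendre`: a square root among 0, …, p - 1.
    SquareBelow : ℤ → Set
    SquareBelow m = Σ (Fin p) λ x → p ∣ℕ ∣ + toℕ x * + toℕ x - m ∣

    squareBelow⇒square : ∀ {m} → SquareBelow m → IsSquare m
    squareBelow⇒square (x , p∣x²-m) = + toℕ x , -≈0⇒≈ (∣⇒≈0 p∣x²-m)

    square⇒squareBelow : ∀ {m} → IsSquare m → SquareBelow m
    square⇒squareBelow (x , x²≈m) = x′ , ≈0⇒∣ (≈⇒-≈0 (≈-trans (*-cong x′≈x x′≈x) x²≈m))
      where
      x′ : Fin p
      x′ = fromℕ< (ℤD.n%ℕd<d x p)
      x′≈x : + toℕ x′ ≈ x
      x′≈x = ≈-trans (≈-reflexive (cong +_ (toℕ-fromℕ< (ℤD.n%ℕd<d x p)))) (≈-sym (≈-%ℕ x))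

  isSquare? : ∀ m → Dec (IsSquare m)
  isSquare? m = Dec.map′ squareBelow⇒square square⇒squareBelow (any? λ x → p ∣? ∣ + toℕ x * + toℕ x - m ∣)

  legendre-∣ : ∀ m → p ∣ℕ ∣ m ∣ → legendre m p ≡ 0ℤ
  legendre-∣ m p∣m with p ∣? ∣ m ∣
  ... | yes _   = refl
  ... | no  p∤m = ⊥-elim (p∤m p∣m)

  legendre-square : ∀ m → ¬ p ∣ℕ ∣ m ∣ → IsSquare m → legendre m p ≡ 1ℤ
  legendre-square m p∤m sq with p ∣? ∣ m ∣
  ... | yes p∣m = ⊥-elim (p∤m p∣m)
  ... | no  _ with any? (λ (x : Fin p) → p ∣? ∣ + toℕ x * + toℕ x - m ∣)
  ...   | yes _   = refl
  ...   | no  ¬sq = ⊥-elim (¬sq (square⇒squareBelow sq))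

  legendre-nonsquare : ∀ m → ¬ p ∣ℕ ∣ m ∣ → ¬ IsSquare m → legendre m p ≡ -1ℤ
  legendre-nonsquare m p∤m ¬sq with p ∣? ∣ m ∣
  ... | yes p∣m = ⊥-elim (p∤m p∣m)
  ... | no  _ with any? (λ (x : Fin p) → p ∣? ∣ + toℕ x * + toℕ x - m ∣)
  ...   | yes sq = ⊥-elim (¬sq (squareBelow⇒square sq))
  ...   | no  _  = refl

  ∣legendre∣≤1 : ∀ m → ∣ legendre m p ∣ ≤ 1
  ∣legendre∣≤1 m with p ∣? ∣ m ∣
  ... | yes _ = z≤n
  ... | no  _ with any? (λ (x : Fin p) → p ∣? ∣ + toℕ x * + toℕ x - m ∣)
  ...   | yes _ = ℕP.≤-refl
  ...   | no  _ = ℕP.≤-refl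

  legendre-1 : 1 < p → legendre 1ℤ p ≡ 1ℤ
  legendre-1 1<p = legendre-square 1ℤ (λ p∣1 → ℕP.<⇒≢ 1<p (sym (ℕ∣.∣1⇒≡1 p∣1))) (1ℤ , ≈-refl)

  legendre-cong : ∀ {m m′} → m ≈ m′ → legendre m p ≡ legendre m′ p
  legendre-cong {m} {m′} m≈m′ = by-cases (p ∣? ∣ m ∣) (isSquare? m)
    where
    p∤-transport : ¬ p ∣ℕ ∣ m ∣ → ¬ p ∣ℕ ∣ m′ ∣
    p∤-transport p∤m = p∤m ∘ ∣-resp-≈ (≈-sym m≈m′)

    by-cases : Dec (p ∣ℕ ∣ m ∣) → Dec (IsSquare m) → legendre m p ≡ legendre m′ p
    by-cases (yes p∣m) _ = trans (legendre-∣ m p∣m) (sym (legendre-∣ m′ (∣-resp-≈ m≈m′ p∣m)))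
    by-cases (no p∤m) (yes (x , x²≈m)) =
      trans (legendre-square m p∤m (x , x²≈m)) (sym (legendre-square m′ (p∤-transport p∤m) (x , ≈-trans x²≈m m≈m′)))
    by-cases (no p∤m) (no ¬sq) =
      trans (legendre-nonsquare m p∤m ¬sq)
            (sym (legendre-nonsquare m′ (p∤-transport p∤m) (λ (x , x²≈m′) → ¬sq (x , ≈-trans x²≈m′ (≈-sym m≈m′)))))

-- Gauss's lemma

-- For r < 2h+1, the least absolute residue of r modulo 2h+1 is -1^ (lar<0 h r) * ∣lar∣ h r.
∣lar∣ : ℕ → ℕ → ℕ
∣lar∣ h r with h <? r
... | yes _ = suc (h ℕ.+ h) ℕ.∸ r
... | no  _ = r

lar<0 : ℕ → ℕ → ℕ
lar<0 h r with h <? r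
... | yes _ = 1
... | no  _ = 0

module _ (h : ℕ) where
  open Mod (suc (h ℕ.+ h))

  lar-≈ : ∀ {r} → r < suc (h ℕ.+ h) → + r ≈ -1^ (lar<0 h r) * + ∣lar∣ h r
  lar-≈ {r} r<p with h <? r
  ... | yes _ = ≈-intro 1ℤ (trans (rearrange (+ r) (+ (p ℕ.∸ r))) (cong (λ z → -1ℤ * 1ℤ * + (p ℕ.∸ r) + 1ℤ * z) p≡r+[p-r]))
    where
    p : ℕ
    p = suc (h ℕ.+ h)
    rearrange : ∀ r s → r ≡ -1ℤ * 1ℤ * s + 1ℤ * (r + s)
    rearrange = solve-∀
    p≡r+[p-r] : + r + + (p ℕ.∸ r) ≡ + p
    p≡r+[p-r] = trans (sym (ℤP.pos-+ r (p ℕ.∸ r))) (cong +_ (ℕP.m+[n∸m]≡n (ℕP.<⇒≤ r<p)))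
  ... | no  _ = ≈-reflexive (sym (ℤP.*-identityˡ (+ r)))

  ∣lar∣∈[1,h] : ∀ {r} → 0 < r → r < suc (h ℕ.+ h) → ∣lar∣ h r ∈[1, h ]
  ∣lar∣∈[1,h] {r} 0<r r<p with h <? r
  ... | yes h<r = ℕP.m<n⇒0<n∸m r<p , ℕP.≤-trans (ℕP.∸-monoʳ-≤ (suc (h ℕ.+ h)) h<r) (ℕP.≤-reflexive (ℕP.m+n∸m≡n h h))
  ... | no  h≮r = 0<r , ℕP.≮⇒≥ h≮r

  -1^-lar : ∀ {r} → r < suc (h ℕ.+ h) → -1^ r ≡ -1^ (∣lar∣ h r ℕ.+ lar<0 h r)
  -1^-lar {r} r<p with h <? r
  ... | yes _ = -1^-parity {r} {g ℕ.+ 1} g h (begin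
    r ℕ.+ 2 ℕ.* g               ≡⟨ rearrange r g ⟩
    (r ℕ.+ g) ℕ.+ g             ≡⟨ cong (ℕ._+ g) (ℕP.m+[n∸m]≡n (ℕP.<⇒≤ r<p)) ⟩
    suc (h ℕ.+ h) ℕ.+ g         ≡⟨ rearrange′ h g ⟩
    g ℕ.+ 1 ℕ.+ 2 ℕ.* h         ∎)
    where
    open ≡-Reasoning
    g : ℕ
    g = suc (h ℕ.+ h) ℕ.∸ r
    rearrange : ∀ r g → r ℕ.+ 2 ℕ.* g ≡ r ℕ.+ g ℕ.+ g
    rearrange = ℕS.solve-∀
    rearrange′ : ∀ h g → suc (h ℕ.+ h) ℕ.+ g ≡ g ℕ.+ 1 ℕ.+ 2 ℕ.* h
    rearrange′ = ℕS.solve-∀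
  ... | no  _ = cong -1^ (sym (ℕP.+-identityʳ r))

module Gauss (h : ℕ) (p-prime : Prime (suc (h ℕ.+ h))) (m : ℤ) (p∤m : ¬ suc (h ℕ.+ h) ∣ℕ ∣ m ∣) where
  p : ℕ
  p = suc (h ℕ.+ h)
  open Mod p

  residue : ℕ → ℕ
  residue x = (m * + x) %ℕ p

  g : ℕ → ℕ
  g x = ∣lar∣ h (residue x)

  ε : ℕ → ℕ
  ε x = lar<0 h (residue x)

  μ : ℕ
  μ = sum (map ε (range h))

  residue<p : ∀ x → residue x < p
  residue<p x = ℤD.n%ℕd<d (m * + x) p

  m*x≈±g : ∀ x → m * + x ≈ -1^ (ε x) * + g x
  m*x≈±g x = ≈-trans (≈-%ℕ (m * + x)) (lar-≈ h (residue<p x))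

  m≉0 : ¬ m ≈ 0ℤ
  m≉0 = p∤m ∘ ≈0⇒∣

  g∈[1,h] : ∀ {x} → x ∈[1, h ] → g x ∈[1, h ]
  g∈[1,h] {x} (1≤x , x≤h) = ∣lar∣∈[1,h] h 0<residue (residue<p x)
    where
    0<residue : 0 < residue x
    0<residue = ℕP.n≢0⇒n>0 λ r≡0 → [ m≉0 , +≉0 1≤x (≤⇒<1+2* x≤h) ]′
      (*≈0⇒≈0⊎≈0 p-prime (≈-trans (≈-%ℕ (m * + x)) (≈-reflexive (cong +_ r≡0))))

  private
    ±-injective : ∀ {x y} → x ∈[1, h ] → y ∈[1, h ] → m * + x ≈ m * + y ⊎ m * + x ≈ - (m * + y) → x ≡ y
    ±-injective (_ , x≤h) (_ , y≤h) (inj₁ mx≈my) =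
      +≈+⇒≡ (*-cancelʳ-≈ p-prime m≉0 (≈-trans (≈-reflexive (ℤP.*-comm _ m)) (≈-trans mx≈my (≈-reflexive (ℤP.*-comm m _)))))
            (≤⇒<1+2* x≤h) (≤⇒<1+2* y≤h)
    ±-injective {x} {y} (1≤x , x≤h) (_ , y≤h) (inj₂ mx≈-my) = ⊥-elim (+≉0 0<x+y x+y<p x+y≈0)
      where
      0<x+y : 0 < x ℕ.+ y
      0<x+y = ℕP.<-≤-trans 1≤x (ℕP.m≤m+n x y)
      x+y<p : x ℕ.+ y < p
      x+y<p = s≤s (ℕP.+-mono-≤ x≤h y≤h)
      factor : ∀ x y m → m * x - - (m * y) ≡ (x + y) * m
      factor = solve-∀
      x+y≈0 : + (x ℕ.+ y) ≈ 0ℤ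
      x+y≈0 = *-cancelʳ-≈ p-prime m≉0
        (≈-trans (≈-reflexive (sym (trans (factor (+ x) (+ y) m) (cong (_* m) (sym (ℤP.pos-+ x y))))))
                 (≈-trans (≈⇒-≈0 mx≈-my) (≈-reflexive (sym (ℤP.*-zeroˡ m)))))

  g-injective : ∀ {x y} → x ∈[1, h ] → y ∈[1, h ] → g x ≡ g y → x ≡ y
  g-injective {x} {y} x∈ y∈ gx≡gy = ±-injective x∈ y∈
    (Data.Sum.map (λ eq → ≈-trans (≈-by-sign eq) (≈-reflexive (ℤP.*-identityˡ (m * + y))))
                  (λ eq → ≈-trans (≈-by-sign eq) (≈-reflexive (ℤP.-1*i≡-i (m * + y))))
                  (-1^-cases (ε x ℕ.+ ε y)))
    where
    σ τ : ℤ
    σ = -1^ (ε x)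
    τ = -1^ (ε y)
    mx≈±my : m * + x ≈ -1^ (ε x ℕ.+ ε y) * (m * + y)
    mx≈±my = begin
      m * + x                 ≈⟨ m*x≈±g x ⟩
      σ * + g x               ≡⟨ cong (λ z → σ * + z) gx≡gy ⟩
      σ * + g y               ≡⟨ cong (σ *_) (trans (cong (_* + g y) (-1^-square (ε y))) (ℤP.*-identityˡ _)) ⟨
      σ * (τ * τ * + g y)     ≡⟨ regroup σ τ (+ g y) ⟩
      σ * τ * (τ * + g y)     ≈⟨ *-congˡ (σ * τ) (≈-sym (m*x≈±g y)) ⟩
      σ * τ * (m * + y)       ≡⟨ cong (_* (m * + y)) (sym (-1^-+ (ε x) (ε y))) ⟩
      -1^ (ε x ℕ.+ ε y) * (m * + y) ∎
      where
      open ≈-Reasoning ≈-setoid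
      regroup : ∀ a b c → a * (b * b * c) ≡ a * b * (b * c)
      regroup = solve-∀
    ≈-by-sign : ∀ {s} → -1^ (ε x ℕ.+ ε y) ≡ s → m * + x ≈ s * (m * + y)
    ≈-by-sign eq = ≈-trans mx≈±my (≈-reflexive (cong (_* (m * + y)) eq))

  map-g-↭range : map g (range h) ↭ range h
  map-g-↭range = unique-length≡⇒↭range h
    (unique-map⁺ (λ x∈ y∈ → g-injective (∈-range⁻ h x∈) (∈-range⁻ h y∈)) (range-unique h))
    (All.map⁺ (All.tabulate (λ x∈ → g∈[1,h] (∈-range⁻ h x∈))))
    (trans (length-map g (range h)) (length-range h))

  gauss-lemma : m ^ h ≈ -1^ μ
  gauss-lemma = *-cancelʳ-≈ p-prime h!≉0 (begin
    m ^ h * h!                                   ≡⟨ cong (_* h!) m^h≡∏m ⟩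
    ∏ (map (λ _ → m) R) * h!                     ≡⟨ ∏-map-* (λ _ → m) +_ R ⟨
    ∏ (map (λ x → m * + x) R)                    ≈⟨ ∏-cong {xs = R} (All.tabulate λ {x} _ → m*x≈±g x) ⟩
    ∏ (map (λ x → -1^ (ε x) * + g x) R)          ≡⟨ ∏-map-* (-1^ ∘ ε) (+_ ∘ g) R ⟩
    ∏ (map (-1^ ∘ ε) R) * ∏ (map (+_ ∘ g) R)     ≡⟨ cong₂ _*_ (∏-map--1^ ε R) ∏g≡h! ⟩
    -1^ μ * h!                                   ∎)
    where
    open ≈-Reasoning ≈-setoid
    R : List ℕ
    R = range h
    h! : ℤ
    h! = ∏ (map +_ R)
    h!≉0 : ¬ h! ≈ 0ℤ
    h!≉0 = ∏≉0 p-prime (All.map⁺ (All.tabulate λ x∈ → let 1≤x , x≤h = ∈-range⁻ h x∈ in +≉0 1≤x (≤⇒<1+2* x≤h)))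
    m^h≡∏m : m ^ h ≡ ∏ (map (λ _ → m) R)
    m^h≡∏m = trans (cong (m ^_) (sym (length-range h))) (sym (∏-map-const m R))
    ∏g≡h! : ∏ (map (+_ ∘ g) R) ≡ h!
    ∏g≡h! = trans (cong ∏ (map-∘ R)) (∏-↭ (↭.map⁺ +_ map-g-↭range))

-- Euler's criterion

odd-prime⇒1≤h : ∀ {h} → Prime (suc (h ℕ.+ h)) → 1 ≤ h
odd-prime⇒1≤h {zero}  p-prime = ⊥-elim (ℕP.<-irrefl refl (prime⇒1< p-prime))
odd-prime⇒1≤h {suc h} _       = s≤s z≤n

module Euler (h : ℕ) (p-prime : Prime (suc (h ℕ.+ h))) where
  p : ℕ
  p = suc (h ℕ.+ h)
  open Mod p
  open Legendre p

  private
    2h : ℕ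
    2h = h ℕ.+ h

    1≤h : 1 ≤ h
    1≤h = odd-prime⇒1≤h p-prime

    2h≈-1 : + 2h ≈ -1ℤ
    2h≈-1 = ≈-intro 1ℤ (rearrange (+ 2h))
      where
      rearrange : ∀ a → a ≡ -1ℤ + 1ℤ * (1ℤ + a)
      rearrange = solve-∀

    divide : ∀ {m} → ¬ m ≈ 0ℤ → ∀ {x} → 0 < x × x < p → Σ ℕ λ y → (0 < y × y < p) × + x * + y ≈ m
    divide {m} m≉0 {x} bx = y , (0<y , ℤD.n%ℕd<d (m * u) p) , xy≈m
      where
      u : ℤ
      u = proj₁ (inverse p-prime (uncurry +≉0 bx))
      y : ℕ
      y = (m * u) %ℕ p
      xy≈m : + x * + y ≈ m
      xy≈m = begin
        + x * + y      ≈⟨ *-congˡ (+ x) (≈-sym (≈-%ℕ (m * u))) ⟩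
        + x * (m * u)  ≡⟨ regroup (+ x) m u ⟩
        m * (+ x * u)  ≈⟨ *-congˡ m (proj₂ (inverse p-prime (uncurry +≉0 bx))) ⟩
        m * 1ℤ         ≡⟨ ℤP.*-identityʳ m ⟩
        m              ∎
        where
        open ≈-Reasoning ≈-setoid
        regroup : ∀ x m u → x * (m * u) ≡ m * (x * u)
        regroup = solve-∀
      0<y : 0 < y
      0<y = ℕP.n≢0⇒n>0 λ y≡0 → m≉0 (≈-trans (≈-sym xy≈m) (≈-reflexive (trans (cong (λ z → + x * + z) y≡0) (ℤP.*-zeroʳ (+ x)))))

  private
    n 2h′ : ℕ
    n = 2h ℕ.∸ 2
    2h′ = suc (suc n)
    2h≡2+n : 2h′ ≡ 2h
    2h≡2+n = ℕP.m+[n∸m]≡n (ℕP.+-mono-≤ 1≤h 1≤h)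
    mids : List ℕ
    mids = map suc (range n)

    ∈-mids⁻ : ∀ {x} → x ∈ mids → 2 ≤ x × x ≤ suc n
    ∈-mids⁻ x∈ with x′ , x′∈ , refl ← ∈-map⁻ suc x∈ = Data.Product.map s≤s s≤s (∈-range⁻ n x′∈)

    ∈-mids⁺ : ∀ {x} → 2 ≤ x → x ≤ suc n → x ∈ mids
    ∈-mids⁺ {suc x} (s≤s 1≤x) (s≤s x≤n) = ∈-map⁺ suc (∈-range⁺ n (1≤x , x≤n))

    ≤1+n⇒<2h : ∀ {x} → x ≤ suc n → x < 2h
    ≤1+n⇒<2h {x} x≤1+n = subst (x <_) 2h≡2+n (s≤s x≤1+n)

    mids-bounds : ∀ {x} → x ∈ mids → 0 < x × x < p
    mids-bounds x∈ = let 2≤x , x≤1+n = ∈-mids⁻ x∈ in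
      ℕP.<-trans (s≤s z≤n) 2≤x , ℕP.<-trans (≤1+n⇒<2h x≤1+n) (ℕP.n<1+n 2h)

    mids-≉±1 : ∀ {x} → x ∈ mids → ¬ + x ≈ 1ℤ × ¬ + x ≈ -1ℤ
    mids-≉±1 x∈ = let 2≤x , x≤1+n = ∈-mids⁻ x∈ ; _ , x<p = mids-bounds x∈ in
        (λ x≈1 → ℕP.<⇒≢ 2≤x (sym (+≈+⇒≡ x≈1 x<p (prime⇒1< p-prime))))
      , (λ x≈-1 → ℕP.<⇒≢ (≤1+n⇒<2h x≤1+n) (+≈+⇒≡ (≈-trans x≈-1 (≈-sym 2h≈-1)) x<p (ℕP.n<1+n 2h)))

    mids-partner : ∀ {x} → x ∈ mids → HasPartner p-prime 1ℤ mids x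
    mids-partner {x} x∈ = from-inverse (divide (1≉0 p-prime) (mids-bounds x∈))
      where
      from-inverse : (Σ ℕ λ y → (0 < y × y < p) × + x * + y ≈ 1ℤ) → HasPartner p-prime 1ℤ mids x
      from-inverse (y , (0<y , y<p) , xy≈1) = y , ∈-mids⁺ 2≤y y≤1+n , y≢x , xy≈1
        where
        x≉1 : ¬ + x ≈ 1ℤ
        x≉1 = proj₁ (mids-≉±1 x∈)
        x≉-1 : ¬ + x ≈ -1ℤ
        x≉-1 = proj₂ (mids-≉±1 x∈)
        y≢1 : ¬ y ≡ 1
        y≢1 refl = x≉1 (≈-trans (≈-reflexive (sym (ℤP.*-identityʳ (+ x)))) xy≈1)
        y≢2h : ¬ y ≡ 2h
        y≢2h refl = x≉-1 (≈-trans (≈-reflexive (sym (ℤP.neg-involutive (+ x))))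
          (-‿cong (≈-trans (≈-reflexive (trans (sym (ℤP.-1*i≡-i (+ x))) (ℤP.*-comm -1ℤ (+ x))))
                            (≈-trans (*-congˡ (+ x) (≈-sym 2h≈-1)) xy≈1))))
        y≢x : ¬ y ≡ x
        y≢x refl = [ x≉1 , x≉-1 ]′ (square≈1⇒≈1⊎≈-1 p-prime xy≈1)
        2≤y : 2 ≤ y
        2≤y = ℕP.≤∧≢⇒< 0<y (y≢1 ∘ sym)
        y≤1+n : y ≤ suc n
        y≤1+n = ℕP.≤-pred (subst (y <_) (sym 2h≡2+n) (ℕP.≤∧≢⇒< (ℕP.≤-pred y<p) y≢2h))

    mids-paired : Σ ℕ λ k → length mids ≡ k ℕ.+ k × ∏ (map +_ mids) ≈ 1ℤ ^ k
    mids-paired = pairing p-prime (length mids) refl (Unique.map⁺ ℕP.suc-injective (range-unique n))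
                     (All.tabulate mids-bounds) mids-partner

  -- Wilson: the residues 2, …, 2h-1 pair off with their inverses.
  wilson : ∏ (map +_ (range 2h)) ≈ -1ℤ
  wilson = begin
    ∏ (map +_ (range 2h))                  ≡⟨ cong (∏ ∘ map +_ ∘ range) 2h≡2+n ⟨
    + 2h′ * ∏ (map +_ (range (suc n)))     ≡⟨ cong (+ 2h′ *_) (∏-range-suc n) ⟩
    + 2h′ * ∏ (map +_ mids)                ≈⟨ *-congˡ (+ 2h′) (proj₂ (proj₂ mids-paired)) ⟩
    + 2h′ * 1ℤ ^ proj₁ mids-paired         ≡⟨ cong (+ 2h′ *_) (ℤP.^-zeroˡ (proj₁ mids-paired)) ⟩
    + 2h′ * 1ℤ                             ≡⟨ cong (λ z → + z * 1ℤ) 2h≡2+n ⟩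
    + 2h * 1ℤ                              ≡⟨ ℤP.*-identityʳ (+ 2h) ⟩
    + 2h                                   ≈⟨ 2h≈-1 ⟩
    -1ℤ                                    ∎
    where open ≈-Reasoning ≈-setoid

  -- A non-residue m pairs each x with m / x, so (2h)! ≈ m ^ h.
  nonresidue-power : ∀ {m} → ¬ m ≈ 0ℤ → ¬ IsSquare m → m ^ h ≈ -1ℤ
  nonresidue-power {m} m≉0 ¬sq = begin
    m ^ h                    ≡⟨ cong (m ^_) k≡h ⟨
    m ^ k                    ≈⟨ ≈-sym (proj₂ (proj₂ paired)) ⟩
    ∏ (map +_ (range 2h))    ≈⟨ wilson ⟩
    -1ℤ                      ∎
    where
    open ≈-Reasoning ≈-setoid
    bounds : ∀ {x} → x ∈ range 2h → 0 < x × x < p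
    bounds x∈ = let 1≤x , x≤2h = ∈-range⁻ 2h x∈ in 1≤x , s≤s x≤2h
    partner : ∀ {x} → x ∈ range 2h → HasPartner p-prime m (range 2h) x
    partner {x} x∈ = from-quotient (divide m≉0 (bounds x∈))
      where
      from-quotient : (Σ ℕ λ y → (0 < y × y < p) × + x * + y ≈ m) → HasPartner p-prime m (range 2h) x
      from-quotient (y , (0<y , y<p) , xy≈m) =
        y , ∈-range⁺ 2h (0<y , ℕP.≤-pred y<p) , (λ { refl → ¬sq (+ x , xy≈m) }) , xy≈m
    paired : Σ ℕ λ k → 2h ≡ k ℕ.+ k × ∏ (map +_ (range 2h)) ≈ m ^ k
    paired = pairing p-prime 2h (length-range 2h) (range-unique 2h) (All.tabulate bounds) partner
    k : ℕ
    k = proj₁ paired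
    k≡h : k ≡ h
    k≡h = sym (+-double-injective (proj₁ (proj₂ paired)))

  euler-criterion : ∀ m → legendre m p ≈ m ^ h
  euler-criterion m = by-cases (p ∣? ∣ m ∣) (isSquare? m)
    where
    open ≈-Reasoning ≈-setoid
    by-cases : Dec (p ∣ℕ ∣ m ∣) → Dec (IsSquare m) → legendre m p ≈ m ^ h
    by-cases (yes p∣m) _ = begin
      legendre m p   ≡⟨ legendre-∣ m p∣m ⟩
      0ℤ             ≡⟨ 0^-pos 1≤h ⟨
      0ℤ ^ h         ≈⟨ ^-cong h (∣⇒≈0 p∣m) ⟨
      m ^ h          ∎
    by-cases (no p∤m) (yes (x , x²≈m)) = begin
      legendre m p        ≡⟨ legendre-square m p∤m (x , x²≈m) ⟩
      1ℤ                  ≡⟨ -1^-square (Gauss.μ h p-prime x p∤x) ⟨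
      -1^ μ * -1^ μ       ≈⟨ *-cong (Gauss.gauss-lemma h p-prime x p∤x) (Gauss.gauss-lemma h p-prime x p∤x) ⟨
      x ^ h * x ^ h       ≡⟨ ^-distrib-* x x h ⟨
      (x * x) ^ h         ≈⟨ ^-cong h x²≈m ⟩
      m ^ h               ∎
      where
      p∤x : ¬ p ∣ℕ ∣ x ∣
      p∤x p∣x = p∤m (∣-resp-≈ x²≈m (≈0⇒∣ (≈-trans (*-congʳ x (∣⇒≈0 {x} p∣x)) (≈-reflexive (ℤP.*-zeroˡ x)))))
      μ : ℕ
      μ = Gauss.μ h p-prime x p∤x
    by-cases (no p∤m) (no ¬sq) = begin
      legendre m p   ≡⟨ legendre-nonsquare m p∤m ¬sq ⟩
      -1ℤ            ≈⟨ nonresidue-power (p∤m ∘ ≈0⇒∣) ¬sq ⟨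
      m ^ h          ∎

  private
    3≤p : 3 ≤ p
    3≤p = s≤s (ℕP.+-mono-≤ 1≤h 1≤h)

    sign-≈⇒≡ : ∀ a b → ∣ a ∣ ≤ 1 → ∣ b ∣ ≤ 1 → a ≈ b → a ≡ b
    sign-≈⇒≡ a b = ≈⇒≡-∣∣≤1 3≤p

  legendre-* : ∀ a b → legendre (a * b) p ≡ legendre a p * legendre b p
  legendre-* a b =
    sign-≈⇒≡ _ _ (∣legendre∣≤1 (a * b)) (∣∣≤1-* (legendre a p) (legendre b p) (∣legendre∣≤1 a) (∣legendre∣≤1 b)) (begin
    legendre (a * b) p          ≈⟨ euler-criterion (a * b) ⟩
    (a * b) ^ h                 ≡⟨ ^-distrib-* a b h ⟩
    a ^ h * b ^ h               ≈⟨ *-cong (euler-criterion a) (euler-criterion b) ⟨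
    legendre a p * legendre b p ∎)
    where open ≈-Reasoning ≈-setoid

  legendre-‿1 : legendre -1ℤ p ≡ -1^ h
  legendre-‿1 = sign-≈⇒≡ _ _ (∣legendre∣≤1 -1ℤ) (∣-1^∣≤1 h) (euler-criterion -1ℤ)

  legendre-gauss : ∀ m (p∤m : ¬ p ∣ℕ ∣ m ∣) → legendre m p ≡ -1^ (Gauss.μ h p-prime m p∤m)
  legendre-gauss m p∤m = sign-≈⇒≡ _ _ (∣legendre∣≤1 m) (∣-1^∣≤1 (Gauss.μ h p-prime m p∤m))
                                    (≈-trans (euler-criterion m) (Gauss.gauss-lemma h p-prime m p∤m))

-- Quadratic reciprocity

module Eisenstein (h : ℕ) (p-prime : Prime (suc (h ℕ.+ h))) (w : ℕ) (p∤q : ¬ suc (h ℕ.+ h) ∣ℕ suc (w ℕ.+ w)) where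
  q : ℕ
  q = suc (w ℕ.+ w)
  open Gauss h p-prime (+ q) p∤q

  ⌊qx/p⌋ : ℕ → ℕ
  ⌊qx/p⌋ x = (q ℕ.* x) ℕ./ p

  lattice-sum : ℕ
  lattice-sum = sum (map ⌊qx/p⌋ (range h))

  private
    R : List ℕ
    R = range h

    -- q x = residue x + ⌊qx/p⌋ p, read modulo 2 with q and p odd.
    -1^-x : ∀ x → -1^ x ≡ -1^ (⌊qx/p⌋ x) * (-1^ (g x) * -1^ (ε x))
    -1^-x x = begin
      -1^ x                                  ≡⟨ -1^-parity {x} {r ℕ.+ d} (w ℕ.* x) (h ℕ.* d) x+2wx≡r+d+2hd ⟩
      -1^ (r ℕ.+ d)                          ≡⟨ trans (cong -1^ (ℕP.+-comm r d)) (-1^-+ d r) ⟩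
      -1^ d * -1^ r                          ≡⟨ cong (-1^ d *_) (trans (-1^-lar h (residue<p x)) (-1^-+ (g x) (ε x))) ⟩
      -1^ d * (-1^ (g x) * -1^ (ε x))        ∎
      where
      open ≡-Reasoning
      r d : ℕ
      r = residue x
      d = ⌊qx/p⌋ x
      r≡ : r ≡ (q ℕ.* x) ℕ.% p
      r≡ = cong (_%ℕ p) (sym (ℤP.pos-* q x))
      x+2wx≡r+d+2hd : x ℕ.+ 2 ℕ.* (w ℕ.* x) ≡ r ℕ.+ d ℕ.+ 2 ℕ.* (h ℕ.* d)
      x+2wx≡r+d+2hd = begin
        x ℕ.+ 2 ℕ.* (w ℕ.* x)                ≡⟨ expand-q w x ⟩
        q ℕ.* x                              ≡⟨ ℕD.m≡m%n+[m/n]*n (q ℕ.* x) p ⟩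
        (q ℕ.* x) ℕ.% p ℕ.+ d ℕ.* p          ≡⟨ cong (ℕ._+ d ℕ.* p) r≡ ⟨
        r ℕ.+ d ℕ.* p                        ≡⟨ expand-p r d h ⟩
        r ℕ.+ d ℕ.+ 2 ℕ.* (h ℕ.* d)          ∎
        where
        expand-q : ∀ w x → x ℕ.+ 2 ℕ.* (w ℕ.* x) ≡ suc (w ℕ.+ w) ℕ.* x
        expand-q = ℕS.solve-∀
        expand-p : ∀ r d h → r ℕ.+ d ℕ.* suc (h ℕ.+ h) ≡ r ℕ.+ d ℕ.+ 2 ℕ.* (h ℕ.* d)
        expand-p = ℕS.solve-∀

  eisenstein : legendre (+ q) p ≡ -1^ lattice-sum
  eisenstein = trans (Euler.legendre-gauss h p-prime (+ q) p∤q) μ-parity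
    where
    open ≡-Reasoning
    A D M : ℤ
    A = -1^ (sum (map id R))
    D = -1^ lattice-sum
    M = -1^ μ
    Σg≡Σx : sum (map g R) ≡ sum (map id R)
    Σg≡Σx = trans (ℕL.sum-↭ map-g-↭range) (cong sum (sym (map-id R)))
    μ-parity : M ≡ D
    μ-parity = cancel-signs A D M (-1^-square (sum (map id R))) (-1^-square lattice-sum) (begin
      A                                                          ≡⟨ ∏-map--1^ id R ⟨
      ∏ (map -1^ R)                                              ≡⟨ cong ∏ (map-cong -1^-x R) ⟩
      ∏ (map (λ x → -1^ (⌊qx/p⌋ x) * (-1^ (g x) * -1^ (ε x))) R)  ≡⟨ ∏-map-* (-1^ ∘ ⌊qx/p⌋) _ R ⟩
      D′ * ∏ (map (λ x → -1^ (g x) * -1^ (ε x)) R)                ≡⟨ cong (D′ *_) (∏-map-* (-1^ ∘ g) (-1^ ∘ ε) R) ⟩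
      D′ * (∏ (map (-1^ ∘ g) R) * ∏ (map (-1^ ∘ ε) R))            ≡⟨ cong₂ (λ u v → u * (v * ∏ (map (-1^ ∘ ε) R)))
                                                                          (∏-map--1^ ⌊qx/p⌋ R) (∏-map--1^ g R) ⟩
      D * (-1^ (sum (map g R)) * ∏ (map (-1^ ∘ ε) R))             ≡⟨ cong₂ (λ u v → D * (-1^ u * v)) Σg≡Σx (∏-map--1^ ε R) ⟩
      D * (A * M)                                                ∎)
      where
      D′ : ℤ
      D′ = ∏ (map (-1^ ∘ ⌊qx/p⌋) R)

prime∤prime : ∀ {P Q} → Prime P → Prime Q → ¬ P ≡ Q → ¬ P ∣ℕ Q
prime∤prime P-prime Q-prime P≢Q P∣Q =
  [ (λ P≡1 → ℕP.<⇒≢ (prime⇒1< P-prime) (sym P≡1)) , P≢Q ]′ (prime⇒irreducible Q-prime P∣Q)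

prime∤prime*small : ∀ {P Q x} → Prime P → Prime Q → ¬ P ≡ Q → 0 < x → x < P → ¬ P ∣ℕ Q ℕ.* x
prime∤prime*small P-prime Q-prime P≢Q 0<x x<P P∣Qx =
  [ prime∤prime P-prime Q-prime P≢Q , (λ P∣x → ℕP.<⇒≱ x<P (ℕ∣.∣⇒≤ {{ℕ.>-nonZero 0<x}} P∣x)) ]′ (euclidsLemma _ _ P-prime P∣Qx)

module Reciprocity (h k : ℕ) (P-prime : Prime (suc (h ℕ.+ h))) (Q-prime : Prime (suc (k ℕ.+ k))) (h≢k : ¬ h ≡ k) where
  P Q : ℕ
  P = suc (h ℕ.+ h)
  Q = suc (k ℕ.+ k)

  private
    P≢Q : ¬ P ≡ Q
    P≢Q P≡Q = h≢k (+-double-injective (ℕP.suc-injective P≡Q))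

    below : ∀ a b x → x ≤ a → suc (b ℕ.+ b) ℕ.* x < suc b ℕ.* suc (a ℕ.+ a)
    below a b x x≤a = ℕP.<-≤-trans (s≤s (ℕP.*-monoʳ-≤ (suc (b ℕ.+ b)) x≤a))
                                   (subst (suc (suc (b ℕ.+ b) ℕ.* a) ≤_) (expand a b) (ℕP.m≤m+n _ (b ℕ.+ a)))
      where
      expand : ∀ a b → suc (suc (b ℕ.+ b) ℕ.* a) ℕ.+ (b ℕ.+ a) ≡ suc b ℕ.* suc (a ℕ.+ a)
      expand = ℕS.solve-∀

    Py<Qx : ℕ → ℕ → ℕ
    Py<Qx x y = 𝟙 (P ℕ.* y <? Q ℕ.* x)

    Qx<Py : ℕ → ℕ → ℕ
    Qx<Py x y = 𝟙 (Q ℕ.* x <? P ℕ.* y)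

    S₁ S₂ : ℕ
    S₁ = sum (map (λ x → (Q ℕ.* x) ℕ./ P) (range h))
    S₂ = sum (map (λ y → (P ℕ.* y) ℕ./ Q) (range k))

    S₁-count : S₁ ≡ sum (map (λ x → sum (map (Py<Qx x) (range k))) (range h))
    S₁-count = sum-map-cong {xs = range h} (All.tabulate λ {x} x∈ → let 1≤x , x≤h = ∈-range⁻ h x∈ in
      sym (count-multiples P (Q ℕ.* x) k (prime∤prime*small P-prime Q-prime P≢Q 1≤x (≤⇒<1+2* x≤h)) (below h k x x≤h)))

    S₂-count : S₂ ≡ sum (map (λ y → sum (map (λ x → Qx<Py x y) (range h))) (range k))
    S₂-count = sum-map-cong {xs = range k} (All.tabulate λ {y} y∈ → let 1≤y , y≤k = ∈-range⁻ k y∈ in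
      sym (count-multiples Q (P ℕ.* y) h (prime∤prime*small Q-prime P-prime (P≢Q ∘ sym) 1≤y (≤⇒<1+2* y≤k)) (below k h y y≤k)))

    Py≢Qx : ∀ {x} → x ∈[1, h ] → ∀ y → ¬ P ℕ.* y ≡ Q ℕ.* x
    Py≢Qx (1≤x , x≤h) y Py≡Qx =
      prime∤prime*small P-prime Q-prime P≢Q 1≤x (≤⇒<1+2* x≤h) (divides y (trans (sym Py≡Qx) (ℕP.*-comm P y)))

    -- Each lattice point (x, y) of the rectangle lies strictly on one side of the line P y = Q x.
    one-side : ∀ {x} → x ∈ range h → sum (map (Py<Qx x) (range k)) ℕ.+ sum (map (Qx<Py x) (range k)) ≡ k
    one-side {x} x∈ = begin
      sum (map (Py<Qx x) (range k)) ℕ.+ sum (map (Qx<Py x) (range k)) ≡⟨ sum-map-+ (Py<Qx x) (Qx<Py x) (range k) ⟨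
      sum (map (λ y → Py<Qx x y ℕ.+ Qx<Py x y) (range k))           ≡⟨ sum-map-cong {xs = range k} (All.tabulate λ {y} _ →
                                                                          𝟙-<-trichotomy (Py≢Qx (∈-range⁻ h x∈) y)) ⟩
      sum (map (λ _ → 1) (range k))                                  ≡⟨ sum-map-const 1 (range k) ⟩
      length (range k) ℕ.* 1                                         ≡⟨ trans (ℕP.*-identityʳ _) (length-range k) ⟩
      k                                                              ∎
      where open ≡-Reasoning

  lattice-count : S₁ ℕ.+ S₂ ≡ h ℕ.* k
  lattice-count = begin
    S₁ ℕ.+ S₂                                                          ≡⟨ cong₂ ℕ._+_ S₁-count
                                                                            (trans S₂-count (sum-swap Qx<Py (range h) (range k))) ⟩
    sum (map (λ x → sum (map (Py<Qx x) (range k))) (range h))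
      ℕ.+ sum (map (λ x → sum (map (Qx<Py x) (range k))) (range h))   ≡⟨ sum-map-+ (λ x → sum (map (Py<Qx x) (range k)))
                                                                                   (λ x → sum (map (Qx<Py x) (range k))) (range h) ⟨
    sum (map (λ x → sum (map (Py<Qx x) (range k)) ℕ.+ sum (map (Qx<Py x) (range k))) (range h))
                                                                       ≡⟨ sum-map-cong {xs = range h} (All.tabulate one-side) ⟩
    sum (map (λ _ → k) (range h))                                      ≡⟨ sum-map-const k (range h) ⟩
    length (range h) ℕ.* k                                             ≡⟨ cong (ℕ._* k) (length-range h) ⟩
    h ℕ.* k                                                            ∎
    where open ≡-Reasoning

  quadratic-reciprocity : legendre (+ Q) P * legendre (+ P) Q ≡ -1^ (h ℕ.* k)
  quadratic-reciprocity = begin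
    legendre (+ Q) P * legendre (+ P) Q ≡⟨ cong₂ _*_ (Eisenstein.eisenstein h P-prime k (prime∤prime P-prime Q-prime P≢Q))
                                                     (Eisenstein.eisenstein k Q-prime h (prime∤prime Q-prime P-prime (P≢Q ∘ sym))) ⟩
    -1^ S₁ * -1^ S₂                     ≡⟨ -1^-+ S₁ S₂ ⟨
    -1^ (S₁ ℕ.+ S₂)                     ≡⟨ cong -1^ lattice-count ⟩
    -1^ (h ℕ.* k)                       ∎
    where open ≡-Reasoning

-- The Jacobi symbol

Odd : ℕ → Set
Odd n = n ℕ.% 2 ≡ 1

%2≡0⊎%2≡1 : ∀ n → n ℕ.% 2 ≡ 0 ⊎ Odd n
%2≡0⊎%2≡1 n with n ℕ.% 2 | ℕD.m%n<n n 2
... | zero        | _ = inj₁ refl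
... | suc zero    | _ = inj₂ refl
... | suc (suc _) | s≤s (s≤s ())

odd-*ˡ : ∀ a b → Odd (a ℕ.* b) → Odd a
odd-*ˡ a b ab-odd with %2≡0⊎%2≡1 a
... | inj₂ a-odd  = a-odd
... | inj₁ a-even = ⊥-elim (1≢0 (trans (sym ab-odd) (trans (ℕD.%-distribˡ-* a b 2)
                                    (cong (λ r → (r ℕ.* (b ℕ.% 2)) ℕ.% 2) a-even))))
  where
  1≢0 : ¬ 1 ≡ 0
  1≢0 ()

odd-*⁻ : ∀ a b → Odd (a ℕ.* b) → Odd a × Odd b
odd-*⁻ a b ab-odd = odd-*ˡ a b ab-odd , odd-*ˡ b a (subst Odd (ℕP.*-comm a b) ab-odd)

half-odd : ∀ x → suc (x ℕ.+ x) ℕ./ 2 ≡ x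
half-odd x = begin
  suc (x ℕ.+ x) ℕ./ 2          ≡⟨ cong (ℕ._/ 2) (double x) ⟩
  (1 ℕ.+ x ℕ.* 2) ℕ./ 2        ≡⟨ ℕD.+-distrib-/-∣ʳ 1 {x ℕ.* 2} {2} (divides x refl) ⟩
  1 ℕ./ 2 ℕ.+ x ℕ.* 2 ℕ./ 2    ≡⟨ ℕD.m*n/n≡m x 2 ⟩
  x                            ∎
  where
  open ≡-Reasoning
  double : ∀ x → suc (x ℕ.+ x) ≡ 1 ℕ.+ x ℕ.* 2
  double = ℕS.solve-∀

odd⇒≡1+2h : ∀ n → Odd n → n ≡ suc (n ℕ./ 2 ℕ.+ n ℕ./ 2)
odd⇒≡1+2h n n-odd = begin
  n                                  ≡⟨ ℕD.m≡m%n+[m/n]*n n 2 ⟩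
  n ℕ.% 2 ℕ.+ n ℕ./ 2 ℕ.* 2          ≡⟨ cong (ℕ._+ n ℕ./ 2 ℕ.* 2) n-odd ⟩
  1 ℕ.+ n ℕ./ 2 ℕ.* 2                ≡⟨ double (n ℕ./ 2) ⟩
  suc (n ℕ./ 2 ℕ.+ n ℕ./ 2)          ∎
  where
  open ≡-Reasoning
  double : ∀ x → 1 ℕ.+ x ℕ.* 2 ≡ suc (x ℕ.+ x)
  double = ℕS.solve-∀

-1^-half-* : ∀ c a b → Odd a → Odd b →
             -1^ (c ℕ.* ((a ℕ.* b) ℕ./ 2)) ≡ -1^ (c ℕ.* (a ℕ./ 2)) * -1^ (c ℕ.* (b ℕ./ 2))
-1^-half-* c a b a-odd b-odd = begin
  -1^ (c ℕ.* ((a ℕ.* b) ℕ./ 2))                           ≡⟨ cong (λ z → -1^ (c ℕ.* z)) half-ab ⟩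
  -1^ (c ℕ.* (u ℕ.+ v ℕ.+ u ℕ.* v ℕ.* 2))                 ≡⟨ cong -1^ (expand c u v) ⟩
  -1^ (c ℕ.* u ℕ.+ c ℕ.* v ℕ.+ 2 ℕ.* (c ℕ.* (u ℕ.* v)))    ≡⟨ -1^-+2* (c ℕ.* u ℕ.+ c ℕ.* v) (c ℕ.* (u ℕ.* v)) ⟩
  -1^ (c ℕ.* u ℕ.+ c ℕ.* v)                               ≡⟨ -1^-+ (c ℕ.* u) (c ℕ.* v) ⟩
  -1^ (c ℕ.* u) * -1^ (c ℕ.* v)                           ∎
  where
  open ≡-Reasoning
  u v : ℕ
  u = a ℕ./ 2
  v = b ℕ./ 2
  product : ∀ u v → suc (u ℕ.+ u) ℕ.* suc (v ℕ.+ v)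
                    ≡ suc ((u ℕ.+ v ℕ.+ u ℕ.* v ℕ.* 2) ℕ.+ (u ℕ.+ v ℕ.+ u ℕ.* v ℕ.* 2))
  product = ℕS.solve-∀
  half-ab : (a ℕ.* b) ℕ./ 2 ≡ u ℕ.+ v ℕ.+ u ℕ.* v ℕ.* 2
  half-ab = trans (cong (ℕ._/ 2) (trans (cong₂ ℕ._*_ (odd⇒≡1+2h a a-odd) (odd⇒≡1+2h b b-odd)) (product u v))) (half-odd _)
  expand : ∀ c u v → c ℕ.* (u ℕ.+ v ℕ.+ u ℕ.* v ℕ.* 2) ≡ c ℕ.* u ℕ.+ c ℕ.* v ℕ.+ 2 ℕ.* (c ℕ.* (u ℕ.* v))
  expand = ℕS.solve-∀

-1^-half-*₁ : ∀ a b → Odd a → Odd b → -1^ ((a ℕ.* b) ℕ./ 2) ≡ -1^ (a ℕ./ 2) * -1^ (b ℕ./ 2)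
-1^-half-*₁ a b a-odd b-odd = begin
  -1^ ((a ℕ.* b) ℕ./ 2)                          ≡⟨ cong -1^ (ℕP.*-identityˡ ((a ℕ.* b) ℕ./ 2)) ⟨
  -1^ (1 ℕ.* ((a ℕ.* b) ℕ./ 2))                  ≡⟨ -1^-half-* 1 a b a-odd b-odd ⟩
  -1^ (1 ℕ.* (a ℕ./ 2)) * -1^ (1 ℕ.* (b ℕ./ 2))  ≡⟨ cong₂ (λ u v → -1^ u * -1^ v)
                                                          (ℕP.*-identityˡ (a ℕ./ 2)) (ℕP.*-identityˡ (b ℕ./ 2)) ⟩
  -1^ (a ℕ./ 2) * -1^ (b ℕ./ 2)                  ∎
  where open ≡-Reasoning

private
  search-spec : ∀ f d n → 2 ≤ d → d Rough n → n < f ℕ.+ d → 2 ≤ n →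
                Prime (proj₁ (search f d n)) × n ≡ proj₂ (search f d n) ℕ.* proj₁ (search f d n)
  search-spec zero    d n _   d-rough n<d 2≤n = ⊥-elim (ℕP.<⇒≱ n<d (rough⇒≤ {{ℕ.n>1⇒nonTrivial 2≤n}} d-rough))
  search-spec (suc f) d n 2≤d d-rough n<f+d 2≤n with d ∣? n
  ... | yes (divides q n≡qd) = rough∧∣⇒prime {{ℕ.n>1⇒nonTrivial 2≤d}} d-rough (divides q n≡qd) , n≡qd
  ... | no  d∤n = search-spec f (suc d) n (ℕP.m≤n⇒m≤1+n 2≤d) (∤⇒rough-suc d∤n d-rough)
                              (subst (n <_) (sym (ℕP.+-suc f d)) n<f+d) 2≤n

-- The factorisation n = cof n * lpf n that `jacobi` peels off: lpf n is the least prime factor.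
lpf cof : ℕ → ℕ
lpf n = proj₁ (search n 2 n)
cof n = proj₂ (search n 2 n)

lpf-prime : ∀ {n} → 2 ≤ n → Prime (lpf n)
lpf-prime {n} 2≤n = proj₁ (search-spec n 2 n ℕP.≤-refl 2-rough (ℕP.m<m+n n (s≤s z≤n)) 2≤n)

n≡cof*lpf : ∀ {n} → 2 ≤ n → n ≡ cof n ℕ.* lpf n
n≡cof*lpf {n} 2≤n = proj₂ (search-spec n 2 n ℕP.≤-refl 2-rough (ℕP.m<m+n n (s≤s z≤n)) 2≤n)

lpf∣n : ∀ {n} → 2 ≤ n → lpf n ∣ℕ n
lpf∣n {n} 2≤n = divides (cof n) (n≡cof*lpf 2≤n)

cof∣n : ∀ {n} → 2 ≤ n → cof n ∣ℕ n
cof∣n {n} 2≤n = divides (lpf n) (trans (n≡cof*lpf 2≤n) (ℕP.*-comm (cof n) (lpf n)))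

cof<n : ∀ {n} → 2 ≤ n → cof n < n
cof<n {n} 2≤n with cof n | n≡cof*lpf 2≤n
... | zero  | _    = ℕP.<-trans (s≤s z≤n) 2≤n
... | suc c | n≡cp = subst (suc c <_) (sym n≡cp) (ℕP.m<m*n (suc c) (lpf n) (prime⇒1< (lpf-prime 2≤n)))

odd-cof×lpf : ∀ {n} → 2 ≤ n → Odd n → Odd (cof n) × Odd (lpf n)
odd-cof×lpf {n} 2≤n n-odd = odd-*⁻ (cof n) (lpf n) (subst Odd (n≡cof*lpf 2≤n) n-odd)

private
  jac-≤1 : ∀ f m n → n ≤ 1 → jac f m n ≡ 1ℤ
  jac-≤1 zero    m n _   = refl
  jac-≤1 (suc f) m n n≤1 with n ≤? 1
  ... | yes _   = refl
  ... | no  n≰1 = ⊥-elim (n≰1 n≤1)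

  jac-unfold : ∀ f m n → 2 ≤ n → jac (suc f) m n ≡ legendre m (lpf n) * jac f m (cof n)
  jac-unfold f m n 2≤n with n ≤? 1
  ... | yes n≤1 = ⊥-elim (ℕP.<⇒≱ 2≤n n≤1)
  ... | no  _ with search n 2 n
  ...   | _ , _ = refl

  jac-fuel : ∀ f f′ m n → n ≤ f → n ≤ f′ → jac f m n ≡ jac f′ m n
  jac-fuel f f′ m n n≤f n≤f′ with n ≤? 1
  ... | yes n≤1 = trans (jac-≤1 f m n n≤1) (sym (jac-≤1 f′ m n n≤1))
  jac-fuel zero     _        m n n≤0 _    | no n≰1 = ⊥-elim (n≰1 (ℕP.≤-trans n≤0 z≤n))
  jac-fuel (suc _)  zero     m n _   n≤0  | no n≰1 = ⊥-elim (n≰1 (ℕP.≤-trans n≤0 z≤n))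
  jac-fuel (suc f)  (suc f′) m n n≤f n≤f′ | no n≰1 = begin
    jac (suc f) m n                        ≡⟨ jac-unfold f m n 2≤n ⟩
    legendre m (lpf n) * jac f m (cof n)   ≡⟨ cong (legendre m (lpf n) *_) (jac-fuel f f′ m (cof n) (below n≤f) (below n≤f′)) ⟩
    legendre m (lpf n) * jac f′ m (cof n)  ≡⟨ jac-unfold f′ m n 2≤n ⟨
    jac (suc f′) m n                       ∎
    where
    open ≡-Reasoning
    2≤n : 2 ≤ n
    2≤n = ℕP.≰⇒> n≰1
    below : ∀ {g} → n ≤ suc g → cof n ≤ g
    below n≤1+g = ℕP.≤-pred (ℕP.<-≤-trans (cof<n 2≤n) n≤1+g)

jacobi-≤1 : ∀ m {n} → n ≤ 1 → jacobi m n ≡ 1ℤ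
jacobi-≤1 m {n} = jac-≤1 n m n

-- `jacobi` recurses on cof n with fuel n - 1 instead of cof n, hence `jac-fuel`.
jacobi-unfold : ∀ m {n} → 2 ≤ n → jacobi m n ≡ legendre m (lpf n) * jacobi m (cof n)
jacobi-unfold m {suc n} 2≤n = trans (jac-unfold n m (suc n) 2≤n)
  (cong (legendre m (lpf (suc n)) *_) (jac-fuel n (cof (suc n)) m (cof (suc n)) (ℕP.≤-pred (cof<n 2≤n)) ℕP.≤-refl))

jacobi-ind : (P : ℕ → Set) → (∀ {n} → n ≤ 1 → P n) → (∀ {n} → 2 ≤ n → P (cof n) → P n) → ∀ n → P n
jacobi-ind P base step = <-rec P λ n rec → by-cases n rec (n ≤? 1)
  where
  by-cases : ∀ n → (∀ {m} → m < n → P m) → Dec (n ≤ 1) → P n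
  by-cases n rec (yes n≤1) = base n≤1
  by-cases n rec (no  n≰1) = step 2≤n (rec (cof<n 2≤n))
    where
    2≤n : 2 ≤ n
    2≤n = ℕP.≰⇒> n≰1

module OddPrime {P : ℕ} (P-prime : Prime P) (P-odd : Odd P) where
  private
    h : ℕ
    h = P ℕ./ 2
    P≡1+2h : P ≡ suc (h ℕ.+ h)
    P≡1+2h = odd⇒≡1+2h P P-odd
    module E = Euler h (subst Prime P≡1+2h P-prime)

  legendre-* : ∀ a b → legendre (a * b) P ≡ legendre a P * legendre b P
  legendre-* a b = subst (λ p → legendre (a * b) p ≡ legendre a p * legendre b p) (sym P≡1+2h) (E.legendre-* a b)

  legendre-‿1 : legendre -1ℤ P ≡ -1^ h
  legendre-‿1 = subst (λ p → legendre -1ℤ p ≡ -1^ h) (sym P≡1+2h) E.legendre-‿1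

odd-prime-reciprocity : ∀ {P Q} → Prime P → Prime Q → Odd P → Odd Q → ¬ P ≡ Q →
                        legendre (+ Q) P * legendre (+ P) Q ≡ -1^ (P ℕ./ 2 ℕ.* (Q ℕ./ 2))
odd-prime-reciprocity {P} {Q} P-prime Q-prime P-odd Q-odd P≢Q =
  subst₂ (λ p q → legendre (+ q) p * legendre (+ p) q ≡ -1^ (P ℕ./ 2 ℕ.* (Q ℕ./ 2))) (sym P≡) (sym Q≡)
    (Reciprocity.quadratic-reciprocity (P ℕ./ 2) (Q ℕ./ 2) (subst Prime P≡ P-prime) (subst Prime Q≡ Q-prime)
      (λ h≡k → P≢Q (trans P≡ (trans (cong (λ z → suc (z ℕ.+ z)) h≡k) (sym Q≡)))))
  where
  P≡ : P ≡ suc (P ℕ./ 2 ℕ.+ P ℕ./ 2)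
  P≡ = odd⇒≡1+2h P P-odd
  Q≡ : Q ≡ suc (Q ℕ./ 2 ℕ.+ Q ℕ./ 2)
  Q≡ = odd⇒≡1+2h Q Q-odd

private
  lpf-nonZero : ∀ {n} → 2 ≤ n → NonZero (lpf n)
  lpf-nonZero 2≤n = prime⇒nonZero (lpf-prime 2≤n)

∣jacobi∣≤1 : ∀ m n → ∣ jacobi m n ∣ ≤ 1
∣jacobi∣≤1 m = jacobi-ind (λ n → ∣ jacobi m n ∣ ≤ 1)
  (λ n≤1 → subst (λ j → ∣ j ∣ ≤ 1) (sym (jacobi-≤1 m n≤1)) ℕP.≤-refl)
  (λ {n} 2≤n ih → subst (λ j → ∣ j ∣ ≤ 1) (sym (jacobi-unfold m 2≤n))
     (∣∣≤1-* (legendre m (lpf n)) (jacobi m (cof n)) (Legendre.∣legendre∣≤1 (lpf n) {{lpf-nonZero 2≤n}} m) ih))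

jacobi-cong : ∀ n {m m′} → Mod._≈_ n m m′ → jacobi m n ≡ jacobi m′ n
jacobi-cong = jacobi-ind (λ n → ∀ {m m′} → Mod._≈_ n m m′ → jacobi m n ≡ jacobi m′ n)
  (λ {n} n≤1 {m} {m′} _ → trans (jacobi-≤1 m n≤1) (sym (jacobi-≤1 m′ n≤1)))
  (λ {n} 2≤n ih {m} {m′} m≈m′ → begin
    jacobi m n                                   ≡⟨ jacobi-unfold m 2≤n ⟩
    legendre m (lpf n) * jacobi m (cof n)        ≡⟨ cong₂ _*_ (Legendre.legendre-cong (lpf n) {{lpf-nonZero 2≤n}} (≈-∣ (lpf∣n 2≤n) m≈m′))
                                                              (ih (≈-∣ (cof∣n 2≤n) m≈m′)) ⟩
    legendre m′ (lpf n) * jacobi m′ (cof n)      ≡⟨ jacobi-unfold m′ 2≤n ⟨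
    jacobi m′ n                                  ∎)
  where open ≡-Reasoning

jacobi-* : ∀ a b n → Odd n → jacobi (a * b) n ≡ jacobi a n * jacobi b n
jacobi-* a b = jacobi-ind (λ n → Odd n → jacobi (a * b) n ≡ jacobi a n * jacobi b n)
  (λ n≤1 _ → trans (jacobi-≤1 (a * b) n≤1) (sym (cong₂ _*_ (jacobi-≤1 a n≤1) (jacobi-≤1 b n≤1))))
  (λ {n} 2≤n ih n-odd → let cof-odd , lpf-odd = odd-cof×lpf 2≤n n-odd in begin
    jacobi (a * b) n                                                  ≡⟨ jacobi-unfold (a * b) 2≤n ⟩
    legendre (a * b) (lpf n) * jacobi (a * b) (cof n)                 ≡⟨ cong₂ _*_ (OddPrime.legendre-* (lpf-prime 2≤n) lpf-odd a b) (ih cof-odd) ⟩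
    legendre a (lpf n) * legendre b (lpf n) * (jacobi a (cof n) * jacobi b (cof n))
                                                                      ≡⟨ interchange (legendre a (lpf n)) (legendre b (lpf n))
                                                                                     (jacobi a (cof n)) (jacobi b (cof n)) ⟩
    legendre a (lpf n) * jacobi a (cof n) * (legendre b (lpf n) * jacobi b (cof n))
                                                                      ≡⟨ cong₂ _*_ (jacobi-unfold a 2≤n) (jacobi-unfold b 2≤n) ⟨
    jacobi a n * jacobi b n                                           ∎)
  where
  open ≡-Reasoning
  interchange : ∀ w x y z → w * x * (y * z) ≡ w * y * (x * z)
  interchange = solve-∀

jacobi-1 : ∀ n → jacobi 1ℤ n ≡ 1ℤ
jacobi-1 = jacobi-ind (λ n → jacobi 1ℤ n ≡ 1ℤ) (jacobi-≤1 1ℤ)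
  (λ {n} 2≤n ih → trans (jacobi-unfold 1ℤ 2≤n)
    (cong₂ _*_ (Legendre.legendre-1 (lpf n) {{lpf-nonZero 2≤n}} (prime⇒1< (lpf-prime 2≤n))) ih))

jacobi-‿1 : ∀ n → Odd n → jacobi -1ℤ n ≡ -1^ (n ℕ./ 2)
jacobi-‿1 = jacobi-ind (λ n → Odd n → jacobi -1ℤ n ≡ -1^ (n ℕ./ 2)) base
  (λ {n} 2≤n ih n-odd → let cof-odd , lpf-odd = odd-cof×lpf 2≤n n-odd in begin
    jacobi -1ℤ n                                        ≡⟨ jacobi-unfold -1ℤ 2≤n ⟩
    legendre -1ℤ (lpf n) * jacobi -1ℤ (cof n)           ≡⟨ cong₂ _*_ (OddPrime.legendre-‿1 (lpf-prime 2≤n) lpf-odd) (ih cof-odd) ⟩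
    -1^ (lpf n ℕ./ 2) * -1^ (cof n ℕ./ 2)               ≡⟨ ℤP.*-comm (-1^ (lpf n ℕ./ 2)) (-1^ (cof n ℕ./ 2)) ⟩
    -1^ (cof n ℕ./ 2) * -1^ (lpf n ℕ./ 2)               ≡⟨ -1^-half-*₁ (cof n) (lpf n) cof-odd lpf-odd ⟨
    -1^ ((cof n ℕ.* lpf n) ℕ./ 2)                       ≡⟨ cong (λ z → -1^ (z ℕ./ 2)) (n≡cof*lpf 2≤n) ⟨
    -1^ (n ℕ./ 2)                                       ∎)
  where
  open ≡-Reasoning
  base : ∀ {n} → n ≤ 1 → Odd n → jacobi -1ℤ n ≡ -1^ (n ℕ./ 2)
  base {zero}  _ ()
  base {suc zero} _ _ = refl
  base {suc (suc _)} (s≤s ()) _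

coprime-∣ˡ : ∀ {d a b} → d ∣ℕ a → Coprime a b → Coprime d b
coprime-∣ˡ d∣a a⊥b (i∣d , i∣b) = a⊥b (ℕ∣.∣-trans i∣d d∣a , i∣b)

coprime-∣ʳ : ∀ {d a b} → d ∣ℕ b → Coprime a b → Coprime a d
coprime-∣ʳ d∣b a⊥b (i∣a , i∣d) = a⊥b (i∣a , ℕ∣.∣-trans i∣d d∣b)

prime-coprime⇒∤ : ∀ {r b} → Prime r → Coprime r b → ¬ r ∣ℕ b
prime-coprime⇒∤ r-prime r⊥b r∣b = ℕP.<⇒≢ (prime⇒1< r-prime) (sym (r⊥b (ℕ∣.∣-refl , r∣b)))

legendre-jacobi-reciprocity : ∀ {r} → Prime r → Odd r → ∀ b → Odd b → Coprime r b →
                              legendre (+ b) r * jacobi (+ r) b ≡ -1^ (r ℕ./ 2 ℕ.* (b ℕ./ 2))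
legendre-jacobi-reciprocity {r} r-prime r-odd = jacobi-ind
  (λ b → Odd b → Coprime r b → legendre (+ b) r * jacobi (+ r) b ≡ -1^ (r ℕ./ 2 ℕ.* (b ℕ./ 2))) base step
  where
  open ≡-Reasoning
  r′ : ℕ
  r′ = r ℕ./ 2
  base : ∀ {b} → b ≤ 1 → Odd b → Coprime r b → legendre (+ b) r * jacobi (+ r) b ≡ -1^ (r′ ℕ.* (b ℕ./ 2))
  base {zero}        _       ()
  base {suc zero}    _       _ _ =
    trans (cong₂ _*_ (Legendre.legendre-1 r {{prime⇒nonZero r-prime}} (prime⇒1< r-prime)) (jacobi-≤1 (+ r) ℕP.≤-refl))
          (cong -1^ (sym (ℕP.*-zeroʳ r′)))
  base {suc (suc _)} (s≤s ()) _
  step : ∀ {b} → 2 ≤ b → (Odd (cof b) → Coprime r (cof b) → legendre (+ cof b) r * jacobi (+ r) (cof b) ≡ -1^ (r′ ℕ.* (cof b ℕ./ 2))) →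
         Odd b → Coprime r b → legendre (+ b) r * jacobi (+ r) b ≡ -1^ (r′ ℕ.* (b ℕ./ 2))
  step {b} 2≤b ih b-odd r⊥b = begin
    legendre (+ b) r * jacobi (+ r) b                       ≡⟨ cong₂ _*_ legendre-b (jacobi-unfold (+ r) 2≤b) ⟩
    legendre (+ Q) r * legendre (+ P) r * (legendre (+ r) P * jacobi (+ r) Q)
                                                            ≡⟨ regroup (legendre (+ Q) r) (legendre (+ P) r)
                                                                       (legendre (+ r) P) (jacobi (+ r) Q) ⟩
    legendre (+ P) r * legendre (+ r) P * (legendre (+ Q) r * jacobi (+ r) Q)
                                                            ≡⟨ cong₂ _*_ (odd-prime-reciprocity r-prime P-prime r-odd P-odd r≢P)
                                                                         (ih Q-odd (coprime-∣ʳ (cof∣n 2≤b) r⊥b)) ⟩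
    -1^ (r′ ℕ.* (P ℕ./ 2)) * -1^ (r′ ℕ.* (Q ℕ./ 2))         ≡⟨ ℤP.*-comm (-1^ (r′ ℕ.* (P ℕ./ 2))) _ ⟩
    -1^ (r′ ℕ.* (Q ℕ./ 2)) * -1^ (r′ ℕ.* (P ℕ./ 2))         ≡⟨ -1^-half-* r′ Q P Q-odd P-odd ⟨
    -1^ (r′ ℕ.* ((Q ℕ.* P) ℕ./ 2))                          ≡⟨ cong (λ z → -1^ (r′ ℕ.* (z ℕ./ 2))) (n≡cof*lpf 2≤b) ⟨
    -1^ (r′ ℕ.* (b ℕ./ 2))                                  ∎
    where
    P = lpf b
    Q = cof b
    P-prime : Prime P
    P-prime = lpf-prime 2≤b
    Q-odd : Odd Q
    Q-odd = proj₁ (odd-cof×lpf 2≤b b-odd)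
    P-odd : Odd P
    P-odd = proj₂ (odd-cof×lpf 2≤b b-odd)
    r≢P : ¬ r ≡ P
    r≢P r≡P = prime-coprime⇒∤ r-prime r⊥b (subst (_∣ℕ b) (sym r≡P) (lpf∣n 2≤b))
    legendre-b : legendre (+ b) r ≡ legendre (+ Q) r * legendre (+ P) r
    legendre-b = trans (cong (λ z → legendre z r) (trans (cong +_ (n≡cof*lpf 2≤b)) (ℤP.pos-* Q P)))
                       (OddPrime.legendre-* r-prime r-odd (+ Q) (+ P))
    regroup : ∀ w x y z → w * x * (y * z) ≡ x * y * (w * z)
    regroup = solve-∀

jacobi-reciprocity : ∀ a b → Odd a → Odd b → Coprime a b → jacobi (+ a) b * jacobi (+ b) a ≡ -1^ (a ℕ./ 2 ℕ.* (b ℕ./ 2))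
jacobi-reciprocity a b a-odd b-odd = jacobi-ind
  (λ a → Odd a → Coprime a b → jacobi (+ a) b * jacobi (+ b) a ≡ -1^ (a ℕ./ 2 ℕ.* b′)) base step a a-odd
  where
  open ≡-Reasoning
  b′ : ℕ
  b′ = b ℕ./ 2
  base : ∀ {a} → a ≤ 1 → Odd a → Coprime a b → jacobi (+ a) b * jacobi (+ b) a ≡ -1^ (a ℕ./ 2 ℕ.* b′)
  base {zero}        _       ()
  base {suc zero}    _       _ _ = cong₂ _*_ (jacobi-1 b) (jacobi-≤1 (+ b) ℕP.≤-refl)
  base {suc (suc _)} (s≤s ()) _
  step : ∀ {a} → 2 ≤ a → (Odd (cof a) → Coprime (cof a) b → jacobi (+ cof a) b * jacobi (+ b) (cof a) ≡ -1^ (cof a ℕ./ 2 ℕ.* b′)) →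
         Odd a → Coprime a b → jacobi (+ a) b * jacobi (+ b) a ≡ -1^ (a ℕ./ 2 ℕ.* b′)
  step {a} 2≤a ih a-odd a⊥b = begin
    jacobi (+ a) b * jacobi (+ b) a                         ≡⟨ cong₂ _*_ jacobi-a (jacobi-unfold (+ b) 2≤a) ⟩
    jacobi (+ Q) b * jacobi (+ P) b * (legendre (+ b) P * jacobi (+ b) Q)
                                                            ≡⟨ regroup (jacobi (+ Q) b) (jacobi (+ P) b)
                                                                       (legendre (+ b) P) (jacobi (+ b) Q) ⟩
    legendre (+ b) P * jacobi (+ P) b * (jacobi (+ Q) b * jacobi (+ b) Q)
                                                            ≡⟨ cong₂ _*_ (legendre-jacobi-reciprocity P-prime P-odd b b-odd
                                                                            (coprime-∣ˡ (lpf∣n 2≤a) a⊥b))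
                                                                         (ih Q-odd (coprime-∣ˡ (cof∣n 2≤a) a⊥b)) ⟩
    -1^ (P ℕ./ 2 ℕ.* b′) * -1^ (Q ℕ./ 2 ℕ.* b′)             ≡⟨ cong₂ (λ u v → -1^ u * -1^ v)
                                                                       (ℕP.*-comm (P ℕ./ 2) b′) (ℕP.*-comm (Q ℕ./ 2) b′) ⟩
    -1^ (b′ ℕ.* (P ℕ./ 2)) * -1^ (b′ ℕ.* (Q ℕ./ 2))         ≡⟨ ℤP.*-comm (-1^ (b′ ℕ.* (P ℕ./ 2))) _ ⟩
    -1^ (b′ ℕ.* (Q ℕ./ 2)) * -1^ (b′ ℕ.* (P ℕ./ 2))         ≡⟨ -1^-half-* b′ Q P Q-odd P-odd ⟨
    -1^ (b′ ℕ.* ((Q ℕ.* P) ℕ./ 2))                          ≡⟨ cong (λ z → -1^ (b′ ℕ.* (z ℕ./ 2))) (n≡cof*lpf 2≤a) ⟨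
    -1^ (b′ ℕ.* (a ℕ./ 2))                                  ≡⟨ cong -1^ (ℕP.*-comm b′ (a ℕ./ 2)) ⟩
    -1^ (a ℕ./ 2 ℕ.* b′)                                    ∎
    where
    P = lpf a
    Q = cof a
    P-prime : Prime P
    P-prime = lpf-prime 2≤a
    Q-odd : Odd Q
    Q-odd = proj₁ (odd-cof×lpf 2≤a a-odd)
    P-odd : Odd P
    P-odd = proj₂ (odd-cof×lpf 2≤a a-odd)
    jacobi-a : jacobi (+ a) b ≡ jacobi (+ Q) b * jacobi (+ P) b
    jacobi-a = trans (cong (λ z → jacobi z b) (trans (cong +_ (n≡cof*lpf 2≤a)) (ℤP.pos-* Q P)))
                     (jacobi-* (+ Q) (+ P) b b-odd)
    regroup : ∀ w x y z → w * x * (y * z) ≡ y * x * (w * z)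
    regroup = solve-∀

-- Adjacent convergents

Exceptional : ℕ → ℕ → ℕ → Set
Exceptional p q k = (p ℕ.% 4 ≡ 1 × q ℕ.% 4 ≡ 3 × k ℕ.% 2 ≡ 1) ⊎ (p ℕ.% 4 ≡ 3 × q ℕ.% 4 ≡ 1 × k ℕ.% 2 ≡ 0)

-1^-mod2 : ∀ k → -1^ k ≡ -1^ (k ℕ.% 2)
-1^-mod2 k = trans (cong -1^ k≡) (-1^-+2* (k ℕ.% 2) (k ℕ./ 2))
  where
  k≡ : k ≡ k ℕ.% 2 ℕ.+ 2 ℕ.* (k ℕ./ 2)
  k≡ = trans (ℕD.m≡m%n+[m/n]*n k 2) (cong (k ℕ.% 2 ℕ.+_) (ℕP.*-comm (k ℕ./ 2) 2))

parity-view : ∀ k → (k ℕ.% 2 ≡ 0 × -1^ k ≡ 1ℤ) ⊎ (k ℕ.% 2 ≡ 1 × -1^ k ≡ -1ℤ)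
parity-view k with %2≡0⊎%2≡1 k
... | inj₁ k-even = inj₁ (k-even , trans (-1^-mod2 k) (cong -1^ k-even))
... | inj₂ k-odd  = inj₂ (k-odd  , trans (-1^-mod2 k) (cong -1^ k-odd))

private
  odd-%4 : ∀ p → Odd p → p ℕ.% 4 ≡ (1 ℕ.+ 2 ℕ.* (p ℕ./ 2 ℕ.% 2)) ℕ.% 4
  odd-%4 p p-odd = begin
    p ℕ.% 4                                ≡⟨ cong (ℕ._% 4) p≡ ⟩
    (1 ℕ.+ 2 ℕ.* r ℕ.+ j ℕ.* 4) ℕ.% 4      ≡⟨ ℕD.[m+kn]%n≡m%n (1 ℕ.+ 2 ℕ.* r) j 4 ⟩
    (1 ℕ.+ 2 ℕ.* r) ℕ.% 4                  ∎
    where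
    open ≡-Reasoning
    h r j : ℕ
    h = p ℕ./ 2
    r = h ℕ.% 2
    j = h ℕ./ 2
    regroup : ∀ r j → suc (r ℕ.+ j ℕ.* 2 ℕ.+ (r ℕ.+ j ℕ.* 2)) ≡ 1 ℕ.+ 2 ℕ.* r ℕ.+ j ℕ.* 4
    regroup = ℕS.solve-∀
    p≡ : p ≡ 1 ℕ.+ 2 ℕ.* r ℕ.+ j ℕ.* 4
    p≡ = trans (odd⇒≡1+2h p p-odd) (trans (cong (λ z → suc (z ℕ.+ z)) (ℕD.m≡m%n+[m/n]*n h 2)) (regroup r j))

mod4-view : ∀ p → Odd p → (p ℕ.% 4 ≡ 1 × -1^ (p ℕ./ 2) ≡ 1ℤ) ⊎ (p ℕ.% 4 ≡ 3 × -1^ (p ℕ./ 2) ≡ -1ℤ)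
mod4-view p p-odd with parity-view (p ℕ./ 2)
... | inj₁ (h-even , χ≡1)  = inj₁ (trans (odd-%4 p p-odd) (cong (λ r → (1 ℕ.+ 2 ℕ.* r) ℕ.% 4) h-even) , χ≡1)
... | inj₂ (h-odd  , χ≡-1) = inj₂ (trans (odd-%4 p p-odd) (cong (λ r → (1 ℕ.+ 2 ℕ.* r) ℕ.% 4) h-odd) , χ≡-1)

adjacent-sign : ℕ → ℕ → ℕ → ℤ
adjacent-sign p q k = jacobi (-1^ k) q * jacobi (- -1^ k) p * -1^ (p ℕ./ 2 ℕ.* (q ℕ./ 2))

adjacent-sign-even : ∀ p q k → Odd p → -1^ k ≡ 1ℤ → adjacent-sign p q k ≡ -1^ (p ℕ./ 2) * -1^ (p ℕ./ 2) ^ (q ℕ./ 2)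
adjacent-sign-even p q k p-odd ε≡1 = begin
  jacobi (-1^ k) q * jacobi (- -1^ k) p * S ≡⟨ cong (λ ε → jacobi ε q * jacobi (- ε) p * S) ε≡1 ⟩
  jacobi 1ℤ q * jacobi -1ℤ p * S           ≡⟨ cong₂ (λ u v → u * v * S) (jacobi-1 q) (jacobi-‿1 p p-odd) ⟩
  1ℤ * -1^ (p ℕ./ 2) * S                   ≡⟨ cong₂ _*_ (ℤP.*-identityˡ (-1^ (p ℕ./ 2))) (sym (ℤP.^-*-assoc -1ℤ (p ℕ./ 2) (q ℕ./ 2))) ⟩
  -1^ (p ℕ./ 2) * -1^ (p ℕ./ 2) ^ (q ℕ./ 2) ∎
  where
  open ≡-Reasoning
  S : ℤ
  S = -1^ (p ℕ./ 2 ℕ.* (q ℕ./ 2))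

adjacent-sign-odd : ∀ p q k → Odd q → -1^ k ≡ -1ℤ → adjacent-sign p q k ≡ -1^ (q ℕ./ 2) * -1^ (p ℕ./ 2) ^ (q ℕ./ 2)
adjacent-sign-odd p q k q-odd ε≡-1 = begin
  jacobi (-1^ k) q * jacobi (- -1^ k) p * S ≡⟨ cong (λ ε → jacobi ε q * jacobi (- ε) p * S) ε≡-1 ⟩
  jacobi -1ℤ q * jacobi 1ℤ p * S           ≡⟨ cong₂ (λ u v → u * v * S) (jacobi-‿1 q q-odd) (jacobi-1 p) ⟩
  -1^ (q ℕ./ 2) * 1ℤ * S                   ≡⟨ cong₂ _*_ (ℤP.*-identityʳ (-1^ (q ℕ./ 2))) (sym (ℤP.^-*-assoc -1ℤ (p ℕ./ 2) (q ℕ./ 2))) ⟩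
  -1^ (q ℕ./ 2) * -1^ (p ℕ./ 2) ^ (q ℕ./ 2) ∎
  where
  open ≡-Reasoning
  S : ℤ
  S = -1^ (p ℕ./ 2 ℕ.* (q ℕ./ 2))

private
  clash : ∀ {A : Set} {n a b : ℕ} → n ≡ a → n ≡ b → ¬ a ≡ b → A
  clash n≡a n≡b a≢b = ⊥-elim (a≢b (trans (sym n≡a) n≡b))

sign-table : ∀ p q k → Odd p → Odd q →
             (Exceptional p q k → adjacent-sign p q k ≡ -1ℤ) × (¬ Exceptional p q k → adjacent-sign p q k ≡ 1ℤ)
sign-table p q k p-odd q-odd = by-cases (parity-view k) (mod4-view p p-odd) (mod4-view q q-odd)
  where
  q′ : ℕ
  q′ = q ℕ./ 2
  by-cases : (k ℕ.% 2 ≡ 0 × -1^ k ≡ 1ℤ) ⊎ (k ℕ.% 2 ≡ 1 × -1^ k ≡ -1ℤ) →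
             (p ℕ.% 4 ≡ 1 × -1^ (p ℕ./ 2) ≡ 1ℤ) ⊎ (p ℕ.% 4 ≡ 3 × -1^ (p ℕ./ 2) ≡ -1ℤ) →
             (q ℕ.% 4 ≡ 1 × -1^ q′ ≡ 1ℤ) ⊎ (q ℕ.% 4 ≡ 3 × -1^ q′ ≡ -1ℤ) →
             (Exceptional p q k → adjacent-sign p q k ≡ -1ℤ) × (¬ Exceptional p q k → adjacent-sign p q k ≡ 1ℤ)
  by-cases (inj₁ (k0 , ε≡1)) (inj₁ (p1 , χp≡1)) _ =
      (λ { (inj₁ (_ , _ , k1)) → clash k0 k1 λ () ; (inj₂ (p3 , _)) → clash p1 p3 λ () })
    , λ _ → trans (adjacent-sign-even p q k p-odd ε≡1) (trans (cong₂ (λ u v → u * v ^ q′) χp≡1 χp≡1) (cong (1ℤ *_) (ℤP.^-zeroˡ q′)))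
  by-cases (inj₁ (k0 , ε≡1)) (inj₂ (p3 , χp≡-1)) (inj₁ (q1 , χq≡1)) =
      (λ _ → trans (adjacent-sign-even p q k p-odd ε≡1) (trans (cong₂ (λ u v → u * v ^ q′) χp≡-1 χp≡-1) (cong (-1ℤ *_) χq≡1)))
    , λ ¬E → ⊥-elim (¬E (inj₂ (p3 , q1 , k0)))
  by-cases (inj₁ (k0 , ε≡1)) (inj₂ (p3 , χp≡-1)) (inj₂ (q3 , χq≡-1)) =
      (λ { (inj₁ (p1 , _)) → clash p1 p3 λ () ; (inj₂ (_ , q1 , _)) → clash q1 q3 λ () })
    , λ _ → trans (adjacent-sign-even p q k p-odd ε≡1) (trans (cong₂ (λ u v → u * v ^ q′) χp≡-1 χp≡-1) (cong (-1ℤ *_) χq≡-1))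
  by-cases (inj₂ (k1 , ε≡-1)) (inj₁ (p1 , χp≡1)) (inj₁ (q1 , χq≡1)) =
      (λ { (inj₁ (_ , q3 , _)) → clash q1 q3 λ () ; (inj₂ (p3 , _)) → clash p1 p3 λ () })
    , λ _ → trans (adjacent-sign-odd p q k q-odd ε≡-1) (trans (cong₂ (λ u v → u * v ^ q′) χq≡1 χp≡1) (cong (1ℤ *_) (ℤP.^-zeroˡ q′)))
  by-cases (inj₂ (k1 , ε≡-1)) (inj₁ (p1 , χp≡1)) (inj₂ (q3 , χq≡-1)) =
      (λ _ → trans (adjacent-sign-odd p q k q-odd ε≡-1) (trans (cong₂ (λ u v → u * v ^ q′) χq≡-1 χp≡1) (cong (-1ℤ *_) (ℤP.^-zeroˡ q′))))
    , λ ¬E → ⊥-elim (¬E (inj₁ (p1 , q3 , k1)))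
  by-cases (inj₂ (k1 , ε≡-1)) (inj₂ (p3 , χp≡-1)) _ =
      (λ { (inj₁ (p1 , _)) → clash p1 p3 λ () ; (inj₂ (_ , _ , k0)) → clash k0 k1 λ () })
    , λ _ → trans (adjacent-sign-odd p q k q-odd ε≡-1) (trans (cong (λ v → -1^ q′ * v ^ q′) χp≡-1) (-1^-square q′))

units-solve : ∀ {x y a b e f s} → ∣ a ∣ ≤ 1 → y * a ≡ e → x * b ≡ f → a * b ≡ s → e * e ≡ 1ℤ → s * s ≡ 1ℤ →
              x ≡ e * f * s * y
units-solve {x} {y} {a} {b} {e} {f} {s} ∣a∣≤1 ya≡e xb≡f ab≡s e²≡1 s²≡1 = begin
  x                  ≡⟨ trans (sym (ℤP.*-identityʳ x)) (cong (x *_) (sym s²≡1)) ⟩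
  x * (s * s)        ≡⟨ cong (λ z → x * (z * s)) ab≡s ⟨
  x * (a * b * s)    ≡⟨ regroup x a b s ⟩
  x * b * a * s      ≡⟨ cong₂ (λ z w → z * w * s) xb≡f a≡ye ⟩
  f * (y * e) * s    ≡⟨ regroup′ f y e s ⟩
  e * f * s * y      ∎
  where
  open ≡-Reasoning
  regroup : ∀ x a b s → x * (a * b * s) ≡ x * b * a * s
  regroup = solve-∀
  regroup′ : ∀ f y e s → f * (y * e) * s ≡ e * f * s * y
  regroup′ = solve-∀
  a²≡1 : a * a ≡ 1ℤ
  a²≡1 = unit-∣∣≤1 {a} {b} {s} ∣a∣≤1 ab≡s s²≡1
  a≡ye : a ≡ y * e
  a≡ye = begin
    a                  ≡⟨ trans (sym (ℤP.*-identityʳ a)) (cong (a *_) (sym e²≡1)) ⟩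
    a * (e * e)        ≡⟨ cong (λ z → a * (z * e)) ya≡e ⟨
    a * (y * a * e)    ≡⟨ regroup″ a y e ⟩
    a * a * (y * e)    ≡⟨ trans (cong (_* (y * e)) a²≡1) (ℤP.*-identityˡ (y * e)) ⟩
    y * e              ∎
    where
    regroup″ : ∀ a y e → a * (y * a * e) ≡ a * a * (y * e)
    regroup″ = solve-∀

adjacent-coprime : ∀ (u v : ℤ) p q k → v * + p - u * + q ≡ -1^ k → Coprime p q
adjacent-coprime u v p q k det {i} (i∣p , i∣q) = ℕ∣.∣1⇒≡1 (subst (i ∣ℕ_) (∣-1^∣≡1 k) (≈0⇒∣ ε≈0))
  where
  open Mod i
  vanish : ∀ v u → v * 0ℤ - u * 0ℤ ≡ 0ℤ
  vanish = solve-∀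
  ε≈0 : -1^ k ≈ 0ℤ
  ε≈0 = ≈-trans (≈-reflexive (sym det))
          (≈-trans (+-cong (*-congˡ v (∣⇒≈0 i∣p)) (-‿cong (*-congˡ u (∣⇒≈0 i∣q)))) (≈-reflexive (vanish v u)))

jacobi-adjacent-sign : ∀ (u v : ℤ) p q k → Odd p → Odd q → v * + p - u * + q ≡ -1^ k →
                       jacobi u p ≡ adjacent-sign p q k * jacobi v q
jacobi-adjacent-sign u v p q k p-odd q-odd det =
  units-solve (∣jacobi∣≤1 (+ p) q) YA≡e XB≡f
              (jacobi-reciprocity p q p-odd q-odd (adjacent-coprime u v p q k det))
              e²≡1 (-1^-square (p ℕ./ 2 ℕ.* (q ℕ./ 2)))
  where
  ε : ℤ
  ε = -1^ k
  vp≈ε : Mod._≈_ q (v * + p) ε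
  vp≈ε = Mod.≈-intro q u (trans (rearrange (v * + p) (u * + q)) (cong (_+ u * + q) det))
    where
    rearrange : ∀ a b → a ≡ a - b + b
    rearrange = solve-∀
  uq≈-ε : Mod._≈_ p (u * + q) (- ε)
  uq≈-ε = Mod.≈-intro p v (trans (rearrange (v * + p) (u * + q)) (cong (λ z → - z + v * + p) det))
    where
    rearrange : ∀ a b → b ≡ - (a - b) + a
    rearrange = solve-∀
  YA≡e : jacobi v q * jacobi (+ p) q ≡ jacobi ε q
  YA≡e = trans (sym (jacobi-* v (+ p) q q-odd)) (jacobi-cong q vp≈ε)
  XB≡f : jacobi u p * jacobi (+ q) p ≡ jacobi (- ε) p
  XB≡f = trans (sym (jacobi-* u (+ q) p p-odd)) (jacobi-cong p uq≈-ε)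
  e²≡1 : jacobi ε q * jacobi ε q ≡ 1ℤ
  e²≡1 = trans (sym (jacobi-* ε ε q q-odd)) (trans (cong (λ z → jacobi z q) (-1^-square k)) (jacobi-1 q))

jacobi-adjacent : ∀ (u v : ℤ) p q k → Odd p → Odd q → v * + p - u * + q ≡ -1^ k →
                  (Exceptional p q k → jacobi u p ≡ - jacobi v q) × (¬ Exceptional p q k → jacobi u p ≡ jacobi v q)
jacobi-adjacent u v p q k p-odd q-odd det =
    (λ E  → trans u≡σv (trans (cong (_* jacobi v q) (proj₁ signs E)) (ℤP.-1*i≡-i (jacobi v q))))
  , (λ ¬E → trans u≡σv (trans (cong (_* jacobi v q) (proj₂ signs ¬E)) (ℤP.*-identityˡ (jacobi v q))))
  where
  u≡σv : jacobi u p ≡ adjacent-sign p q k * jacobi v q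
  u≡σv = jacobi-adjacent-sign u v p q k p-odd q-odd det
  signs : (Exceptional p q k → adjacent-sign p q k ≡ -1ℤ) × (¬ Exceptional p q k → adjacent-sign p q k ≡ 1ℤ)
  signs = sign-table p q k p-odd q-odd

module _ (a : ℕ → ℤ) (a≥1 : ∀ i → + 1 ℤ.≤ a (suc i)) where
  private
    ≥1⇒natural : ∀ {z} → + 1 ℤ.≤ z → Σ ℕ λ c → z ≡ + c
    ≥1⇒natural {+ c} _ = c , refl

    t-natural² : ∀ k → (Σ ℕ λ T → t a k ≡ + T) × (Σ ℕ λ T → t a (suc k) ≡ + T)
    t-natural² zero with c , a₁≡c ← ≥1⇒natural (a≥1 0) =
      (1 , refl) , (c , trans (ℤP.+-identityʳ (a 1 * 1ℤ)) (trans (ℤP.*-identityʳ (a 1)) a₁≡c))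
    t-natural² (suc k) with (T , t₀≡T) , (T′ , t₁≡T′) ← t-natural² k | c , a≡c ← ≥1⇒natural (a≥1 (suc k)) =
      (T′ , t₁≡T′) , (c ℕ.* T′ ℕ.+ T , (begin
        a (suc (suc k)) * t a (suc k) + t a k   ≡⟨ cong₂ (λ x y → x * y + t a k) a≡c t₁≡T′ ⟩
        + c * + T′ + t a k                      ≡⟨ cong₂ _+_ (sym (ℤP.pos-* c T′)) t₀≡T ⟩
        + (c ℕ.* T′) + + T                      ≡⟨ ℤP.pos-+ (c ℕ.* T′) T ⟨
        + (c ℕ.* T′ ℕ.+ T)                      ∎))
      where open ≡-Reasoning

  t-natural : ∀ k → Σ ℕ λ T → t a k ≡ + T
  t-natural k = proj₁ (t-natural² k)

convergent-determinant : ∀ a k → s a (suc k) * t a k - s a k * t a (suc k) ≡ -1^ k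
convergent-determinant a zero    = base (a 0) (a 1)
  where
  base : ∀ a₀ a₁ → (a₁ * a₀ + 1ℤ) * 1ℤ - a₀ * (a₁ * 1ℤ + 0ℤ) ≡ 1ℤ
  base = solve-∀
convergent-determinant a (suc k) = begin
  s a (suc (suc k)) * t a (suc k) - s a (suc k) * t a (suc (suc k))
    ≡⟨ flip (a (suc (suc k))) (s a (suc k)) (s a k) (t a (suc k)) (t a k) ⟩
  - (s a (suc k) * t a k - s a k * t a (suc k))                       ≡⟨ cong -_ (convergent-determinant a k) ⟩
  - -1^ k                                                             ≡⟨ ℤP.-1*i≡-i (-1^ k) ⟨
  -1^ (suc k)                                                         ∎
  where
  open ≡-Reasoning
  flip : ∀ c s₁ s₀ t₁ t₀ → (c * s₁ + s₀) * t₁ - s₁ * (c * t₁ + t₀) ≡ - (s₁ * t₀ - s₀ * t₁)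
  flip = solve-∀

lemma1 : (a : ℕ → ℤ) → (∀ i → + 1 ℤ.≤ a (suc i)) → (k : ℕ) →
         t a k %ℕ 2 ≡ 1 → t a (suc k) %ℕ 2 ≡ 1 →
         let E = (t a k %ℕ 4 ≡ 1 × t a (suc k) %ℕ 4 ≡ 3 × k ℕ.% 2 ≡ 1)
                 ⊎ (t a k %ℕ 4 ≡ 3 × t a (suc k) %ℕ 4 ≡ 1 × k ℕ.% 2 ≡ 0)
         in (E → jacobi (s a k) ∣ t a k ∣ ≡ - jacobi (s a (suc k)) ∣ t a (suc k) ∣)
            × (¬ E → jacobi (s a k) ∣ t a k ∣ ≡ jacobi (s a (suc k)) ∣ t a (suc k) ∣)
lemma1 a a≥1 k tₖ-odd tₖ₊₁-odd
  with det ← convergent-determinant a k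
  with p , tₖ≡p ← t-natural a a≥1 k
  with q , tₖ₊₁≡q ← t-natural a a≥1 (suc k)
  rewrite tₖ≡p | tₖ₊₁≡q
  = jacobi-adjacent (s a k) (s a (suc k)) p q k tₖ-odd tₖ₊₁-odd det
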